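{- Let $\alpha$ be an ordinal, let $(A,B)\in\overline{\mathbb{R}}_\alpha$ be a proper Dedekind cut and $(C,D)\in\overline{\mathbb{R}}_\alpha$ an improper Dedekind cut. Then their sum $(A+C,B+D)$ is an improper Dedekind cut.
   Context: For an ordinal $\alpha$, let $\mathbb{N}_\alpha$ be the set of ordinals strictly less than $\omega^{\omega^\alpha}$ with the ordinal order and the natural (Hessenberg) sum and product. Let $\mathbb{Z}_\alpha$ be the classes of pairs $(a,b)\in\mathbb{N}_\alpha^2$ under $(a,b)\sim(c,d)\iff a+d=b+c$, with $(a,b)+(c,d)=(a+c,b+d)$, $(a,b)(c,d)=(ac+bd,ad+bc)$, order $[(a_1,a_2)]\ge[(b_1,b_2)]\iff a_1+b_2\ge a_2+b_1$. Let $\mathbb{Q}_\alpha$ be its field of fractions (classes of $(a,b)$, $b\ne0$, under $ad=bc$, usual fraction operations), a linearly ordered field with $A\ge0$ iff $ab\ge0$ for representatives and $A\ge B$ iff $A-B\ge0$; $\mathbb{Q}_\alpha^+$ denotes its positive elements. A Dedekind cut on $\mathbb{Q}_\alpha$ is a pair $(A,B)$ of subsets such that: every element of $A$ is less than every element of $B$; $\mathbb{Q}_\alpha\setminus(A\cup B)$ has at most one element; $\inf(B)\notin B$ and $\sup(A)\notin A$; $A\cap B=\varnothing$. $\overline{\mathbb{R}}_\alpha$ is the set of all Dedekind cuts on $\mathbb{Q}_\alpha$. A ball in $\mathbb{Q}_\alpha$ is a set $\{y\in\mathbb{Q}_\alpha: |x-y|<r\}$, $x\in\mathbb{Q}_\alpha$,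 $r\in\mathbb{Q}_\alpha^+$. A cut $(A,B)$ is improper if there exists $d\in\mathbb{Q}_\alpha^+$ such that every ball $U$ meeting both $A$ and $B$ satisfies $\sup(U)-\inf(U)>d$; otherwise it is proper. The sum of cuts is $(A,B)+(C,D)=(A+C,B+D)$, where $X+Y=\{x+y: x\in X, y\in Y\}$. -}

module Defs where

open import Level using (0ℓ)
open import Data.Bool using (Bool; true; false; if_then_else_; _∧_; not; T)
open import Data.List using (List; []; _∷_; _++_; map; concatMap; foldr)
open import Data.Product using (Σ; _×_; _,_; proj₁; proj₂)
open import Data.Sum using (_⊎_)
open import Data.Empty using (⊥)
open import Relation.Nullary using (¬_)
open import Relation.Binary.PropositionalEquality using (_≡_)
open import Relation.Binary using (Rel; IsStrictTotalOrder; Tri; tri<; tri≈; tri>)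
open import Induction.WellFounded using (WellFounded)

-- An ordinal α, given as a well-ordered set (strict total order w.r.t. ≡,
-- well-founded).  Elements of the carrier are the ordinals β < α.
record Ordinal : Set₁ where
  field
    Carrier            : Set
    _<_                : Rel Carrier 0ℓ
    isStrictTotalOrder : IsStrictTotalOrder _≡_ _<_
    wellFounded        : WellFounded _<_

data Cmp : Set where
  lt eq gt : Cmp

cmpList : {X : Set} → (X → X → Cmp) → List X → List X → Cmp
cmpList c [] [] = eq
cmpList c [] (_ ∷ _) = lt
cmpList c (_ ∷ _) [] = gt
cmpList c (x ∷ xs) (y ∷ ys) with c x y
... | lt = lt
... | gt = gt
... | eq = cmpList c xs ys

insertBy : {X : Set} → (X → X → Cmp) → X → List X → List X
insertBy c x [] = x ∷ []
insertBy c x (y ∷ ys) with c x y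
... | lt = y ∷ insertBy c x ys
... | _  = x ∷ y ∷ ys

-- sort into non-increasing order
sortBy : {X : Set} → (X → X → Cmp) → List X → List X
sortBy c = foldr (insertBy c) []

isGT : Cmp → Bool
isGT gt = true
isGT _  = false

isEQ : Cmp → Bool
isEQ eq = true
isEQ _  = false

module Arith (α : Ordinal) where
  open Ordinal α using (isStrictTotalOrder) renaming (Carrier to Ob)
  open IsStrictTotalOrder isStrictTotalOrder using (compare)

  cmpOb : Ob → Ob → Cmp
  cmpOb x y with compare x y
  ... | tri< _ _ _ = lt
  ... | tri≈ _ _ _ = eq
  ... | tri> _ _ _ = gt

  -- Ordinals below ω^α: a finite multiset [β₁,…,βₖ] of ordinals β < α
  -- represents ω^β₁ ⊕ … ⊕ ω^βₖ (Cantor normal form after sorting the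
  -- β's non-increasingly).  Ordinal order = lexicographic order of the
  -- sorted lists.
  Exp : Set
  Exp = List Ob

  normE : Exp → Exp
  normE = sortBy cmpOb

  cmpE : Exp → Exp → Cmp
  cmpE e f = cmpList cmpOb (normE e) (normE f)

  -- ℕ_α: ordinals below ω^(ω^α).  A finite multiset [γ₁,…,γₘ] of
  -- ordinals γ < ω^α represents ω^γ₁ ⊕ … ⊕ ω^γₘ.  Elements are taken up
  -- to the equivalence "same normal form".
  N : Set
  N = List Exp

  normN : N → List Exp
  normN a = sortBy cmpE (map normE a)

  cmpN : N → N → Cmp
  cmpN a b = cmpList cmpE (normN a) (normN b)

  _⊕_ : N → N → N
  a ⊕ b = a ++ b

  -- ω^γ ⊗ ω^δ = ω^(γ ⊕ δ), extended bilinearly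
  _⊗_ : N → N → N
  a ⊗ b = concatMap (λ e → map (λ f → e ++ f) b) a

  zeroN oneN : N
  zeroN = []
  oneN  = [] ∷ []

  leN : N → N → Bool
  leN a b = not (isGT (cmpN a b))

  eqN : N → N → Bool
  eqN a b = isEQ (cmpN a b)

  -- ℤ_α : pairs (a,b) up to a + d = b + c
  Z : Set
  Z = N × N

  eqZ : Z → Z → Bool
  eqZ (a , b) (c , d) = eqN (a ⊕ d) (b ⊕ c)

  addZ mulZ : Z → Z → Z
  addZ (a , b) (c , d) = (a ⊕ c , b ⊕ d)
  mulZ (a , b) (c , d) = ((a ⊗ c) ⊕ (b ⊗ d) , (a ⊗ d) ⊕ (b ⊗ c))

  negZ : Z → Z
  negZ (a , b) = (b , a)

  geZ : Z → Z → Bool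
  geZ (a₁ , a₂) (b₁ , b₂) = leN (a₂ ⊕ b₁) (a₁ ⊕ b₂)

  zeroZ oneZ : Z
  zeroZ = (zeroN , zeroN)
  oneZ  = (oneN , zeroN)

  -- ℚ_α : fractions a/b with b ≠ 0, up to ad = bc.
  -- Raw fraction arithmetic is done on pairs (no nonzeroness needed).
  QR : Set
  QR = Z × Z

  record Q : Set where
    constructor frac
    field
      num den  : Z
      den≢0    : eqZ den zeroZ ≡ false

  raw : Q → QR
  raw q = (Q.num q , Q.den q)

  eqR : QR → QR → Bool
  eqR (a , b) (c , d) = eqZ (mulZ a d) (mulZ b c)

  addR subR : QR → QR → QR
  addR (a , b) (c , d) = (addZ (mulZ a d) (mulZ b c) , mulZ b d)
  subR (a , b) (c , d) = (addZ (mulZ a d) (negZ (mulZ b c)) , mulZ b d)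

  negR : QR → QR
  negR (a , b) = (negZ a , b)

  zeroR : QR
  zeroR = (zeroZ , oneZ)

  nonnegR : QR → Bool
  nonnegR (a , b) = geZ (mulZ a b) zeroZ

  leR : QR → QR → Bool
  leR x y = nonnegR (subR y x)

  ltR : QR → QR → Bool
  ltR x y = leR x y ∧ not (eqR x y)

  absR : QR → QR
  absR x = if nonnegR x then x else negR x

  _≈_ _≤_ _<_ : Q → Q → Set
  x ≈ y = T (eqR (raw x) (raw y))
  x ≤ y = T (leR (raw x) (raw y))
  x < y = T (ltR (raw x) (raw y))

  Positive : Q → Set
  Positive r = T (ltR zeroR (raw r))

  -- Subsets of ℚ_α are predicates (required to respect ≈ for cuts)
  Subset : Set₁
  Subset = Q → Set

  IsSup : Subset → Q → Set
  IsSup S s = (∀ y → S y → y ≤ s) × (∀ u → (∀ y → S y → y ≤ u) → s ≤ u)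

  IsInf : Subset → Q → Set
  IsInf S i = (∀ y → S y → i ≤ y) × (∀ u → (∀ y → S y → u ≤ y) → u ≤ i)

  Respects : Subset → Set
  Respects S = ∀ x y → x ≈ y → S x → S y

  record IsCut (A B : Subset) : Set where
    field
      respA     : Respects A
      respB     : Respects B
      A<B       : ∀ a b → A a → B b → a < b
      gap≤1     : ∀ x y → ¬ (A x ⊎ B x) → ¬ (A y ⊎ B y) → x ≈ y
      infB∉B    : ∀ i → IsInf B i → ¬ B i
      supA∉A    : ∀ s → IsSup A s → ¬ A s
      disjoint  : ∀ x → A x → B x → ⊥

  _+ₛ_ : Subset → Subset → Subset
  (X +ₛ Y) z = Σ Q λ x → Σ Q λ y → X x × Y y × T (eqR (raw z) (addR (raw x) (raw y)))

  Ball : Q → Q → Subset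
  Ball x r y = T (ltR (absR (subR (raw x) (raw y))) (raw r))

  Meets : Subset → Subset → Set
  Meets U S = Σ Q λ y → U y × S y

  Improper : Subset → Subset → Set
  Improper A B =
    Σ Q λ d → Positive d ×
      (∀ x r → Positive r → Meets (Ball x r) A → Meets (Ball x r) B →
        Σ Q λ s → Σ Q λ i → IsSup (Ball x r) s × IsInf (Ball x r) i ×
          T (ltR (raw d) (subR (raw s) (raw i))))

  Proper : Subset → Subset → Set
  Proper A B = ¬ Improper A B

-- An improper cut (C, D) is one whose sides stay a positive distance d apart: if c ∈ C and e ∈ D
-- were closer, a small ball around their midpoint would meet both sides with diameter below d.
-- Adding a cut (A, B) with A below B preserves the distance, as (b + e) - (a + c) ≥ e - c ≥ d,
-- so (A + C, B + D) is improper. It is a cut because no rational z escapes both sums: otherwise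
-- the gap of (C, D) forces b - a ≥ d for all a ∈ A, b ∈ B, making (A, B) improper.

module Submission where

open import Defs
open import Data.Product using (_×_; _,_)
open import Data.Sum using (_⊎_)
open import Relation.Nullary using (¬_)

module Comparison where
  open import Data.Empty using (⊥-elim)
  open import Relation.Binary.PropositionalEquality

  flipCmp : Cmp → Cmp
  flipCmp lt = gt
  flipCmp eq = eq
  flipCmp gt = lt

  flipCmp-involutive : ∀ r → flipCmp (flipCmp r) ≡ r
  flipCmp-involutive lt = refl
  flipCmp-involutive eq = refl
  flipCmp-involutive gt = refl

  thenCmp : Cmp → Cmp → Cmp
  thenCmp lt _ = lt
  thenCmp eq r = r
  thenCmp gt _ = gt

  record IsComparison {X : Set} (c : X → X → Cmp) : Set where
    field
      antisym : ∀ x y → c y x ≡ flipCmp (c x y)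
      eq-substˡ : ∀ {x y} z → c x y ≡ eq → c x z ≡ c y z
      lt-trans : ∀ {x y z} → c x y ≡ lt → c y z ≡ lt → c x z ≡ lt

  lt≢gt : lt ≢ gt
  lt≢gt ()
  eq≢gt : eq ≢ gt
  eq≢gt ()
  lt≢eq : lt ≢ eq
  lt≢eq ()
  eq≢lt : eq ≢ lt
  eq≢lt ()
  gt≢lt : gt ≢ lt
  gt≢lt ()
  gt≢eq : gt ≢ eq
  gt≢eq ()

  IsComparison-on : {X Y : Set} {c : X → X → Cmp} (f : Y → X) → IsComparison c → IsComparison (λ a b → c (f a) (f b))
  IsComparison-on f P = record { antisym = λ x y → antisym (f x) (f y) ; eq-substˡ = λ z → eq-substˡ (f z) ; lt-trans = lt-trans }
    where open IsComparison P

  IsComparison-ext : {X : Set} {c d : X → X → Cmp} → (∀ x y → c x y ≡ d x y) → IsComparison c → IsComparison d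
  IsComparison-ext {c = c} {d} h P = record
    { antisym = λ x y → trans (sym (h y x)) (trans (antisym x y) (cong flipCmp (h x y)))
    ; eq-substˡ = λ {x} {y} z e → trans (sym (h x z)) (trans (eq-substˡ z (trans (h x y) e)) (h y z))
    ; lt-trans = λ {x} {y} {z} e1 e2 → trans (sym (h x z)) (lt-trans (trans (h x y) e1) (trans (h y z) e2)) }
    where open IsComparison P

  module ComparisonProperties {X : Set} {c : X → X → Cmp} (P : IsComparison c) where
    open IsComparison P public

    eq-refl : ∀ x → c x x ≡ eq
    eq-refl x with c x x | antisym x x
    ... | lt | ()
    ... | eq | _ = refl
    ... | gt | ()

    eq-sym : ∀ {x y} → c x y ≡ eq → c y x ≡ eq
    eq-sym {x} {y} e = trans (antisym x y) (cong flipCmp e)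

    lt⇒swap-gt : ∀ {x y} → c x y ≡ lt → c y x ≡ gt
    lt⇒swap-gt {x} {y} e = trans (antisym x y) (cong flipCmp e)

    gt⇒swap-lt : ∀ {x y} → c x y ≡ gt → c y x ≡ lt
    gt⇒swap-lt {x} {y} e = trans (antisym x y) (cong flipCmp e)

    eq-substʳ : ∀ x {y z} → c y z ≡ eq → c x y ≡ c x z
    eq-substʳ x {y} {z} e = begin
        c x y ≡⟨ sym (flipCmp-involutive _) ⟩
        flipCmp (flipCmp (c x y)) ≡⟨ cong flipCmp (sym (antisym x y)) ⟩
        flipCmp (c y x) ≡⟨ cong flipCmp (eq-substˡ x e) ⟩
        flipCmp (c z x) ≡⟨ cong flipCmp (antisym x z) ⟩
        flipCmp (flipCmp (c x z)) ≡⟨ flipCmp-involutive _ ⟩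
        c x z ∎
      where open ≡-Reasoning

    eq-trans : ∀ {x y z} → c x y ≡ eq → c y z ≡ eq → c x z ≡ eq
    eq-trans {x} {y} {z} e1 e2 = trans (eq-substˡ z e1) e2

    lt-≤-trans : ∀ {x y z} → c x y ≡ lt → c y z ≢ gt → c x z ≡ lt
    lt-≤-trans {x} {y} {z} e1 n with c y z in e2
    ... | lt = lt-trans e1 e2
    ... | eq = trans (sym (eq-substʳ x e2)) e1
    ... | gt = ⊥-elim (n refl)

    ≤-lt-trans : ∀ {x y z} → c x y ≢ gt → c y z ≡ lt → c x z ≡ lt
    ≤-lt-trans {x} {y} {z} n e2 with c x y in e1
    ... | lt = lt-trans e1 e2
    ... | eq = trans (eq-substˡ z e1) e2
    ... | gt = ⊥-elim (n refl)

    ≤-≤-trans : ∀ {x y z} → c x y ≢ gt → c y z ≢ gt → c x z ≢ gt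
    ≤-≤-trans {x} {y} {z} n1 n2 with c x y in e1
    ... | lt = λ h → lt≢gt (trans (sym (lt-≤-trans e1 n2)) h)
    ... | eq = λ h → n2 (trans (sym (eq-substˡ z e1)) h)
    ... | gt = ⊥-elim (n1 refl)

    eq-transˡ : ∀ {x y z} → c x y ≡ eq → ∀ {r} → c y z ≡ r → c x z ≡ r
    eq-transˡ {z = z} e h = trans (eq-substˡ z e) h
    eq-transʳ : ∀ {x y z} → c y z ≡ eq → ∀ {r} → c x y ≡ r → c x z ≡ r
    eq-transʳ {x} e h = trans (sym (eq-substʳ x e)) h

    ≮⇒swap-≯ : ∀ {x y} → c x y ≢ lt → c y x ≢ gt
    ≮⇒swap-≯ {x} {y} n h = n (trans (sym (flipCmp-involutive _)) (trans (cong flipCmp (sym (antisym x y))) (cong flipCmp h)))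

    eq-cong₂ : ∀ {x x' y y'} → c x x' ≡ eq → c y y' ≡ eq → c x y ≡ c x' y'
    eq-cong₂ {x} {x'} {y} {y'} e1 e2 = trans (eq-substˡ y e1) (eq-substʳ x' e2)

module MultisetOrder {X : Set} (c : X → X → Cmp) (P : Comparison.IsComparison c) where
  open Comparison

  open import Data.List using (List; []; _∷_; _++_; map; foldr)
  open import Data.List.Relation.Unary.All using (All; []; _∷_)
  open import Data.List.Relation.Binary.Permutation.Propositional as Perm using (_↭_; prep; swap; ↭-sym; ↭-trans; ↭-refl)
  open import Data.Unit using (⊤; tt)
  import Data.List.Relation.Unary.All as AllM
  open import Data.List.Relation.Binary.Permutation.Propositional.Properties using (++-comm)
  open import Data.Product using (_×_; _,_)
  open import Data.Sum using (_⊎_; inj₁; inj₂)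
  open import Data.Empty using (⊥-elim)
  open import Relation.Binary.PropositionalEquality

  open ComparisonProperties P

  -- cmpList, insertBy and sortBy from Defs branch by with-abstraction, whose auxiliary functions
  -- cannot be named, so an equation c x y ≡ lt cannot be substituted into them. lexCmp, insert
  -- and sort are the same functions with named auxiliaries (thenCmp, insertStep); the bridges
  -- below identify the two versions.
  lexCmp : List X → List X → Cmp
  lexCmp [] [] = eq
  lexCmp [] (_ ∷ _) = lt
  lexCmp (_ ∷ _) [] = gt
  lexCmp (x ∷ xs) (y ∷ ys) = thenCmp (c x y) (lexCmp xs ys)

  insertStep : Cmp → X → X → List X → List X → List X
  insertStep lt x y ys r = y ∷ r
  insertStep eq x y ys r = x ∷ y ∷ ys
  insertStep gt x y ys r = x ∷ y ∷ ys

  insert : X → List X → List X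
  insert x [] = x ∷ []
  insert x (y ∷ ys) = insertStep (c x y) x y ys (insert x ys)

  sort : List X → List X
  sort = foldr insert []

  cmpList≡lexCmp : ∀ xs ys → cmpList c xs ys ≡ lexCmp xs ys
  cmpList≡lexCmp [] [] = refl
  cmpList≡lexCmp [] (_ ∷ _) = refl
  cmpList≡lexCmp (_ ∷ _) [] = refl
  cmpList≡lexCmp (x ∷ xs) (y ∷ ys) with c x y
  ... | lt = refl
  ... | eq = cmpList≡lexCmp xs ys
  ... | gt = refl

  insertBy≡insert : ∀ x ys → insertBy c x ys ≡ insert x ys
  insertBy≡insert x [] = refl
  insertBy≡insert x (y ∷ ys) with c x y
  ... | lt = cong (y ∷_) (insertBy≡insert x ys)
  ... | eq = refl
  ... | gt = refl

  sortBy≡sort : ∀ xs → sortBy c xs ≡ sort xs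
  sortBy≡sort [] = refl
  sortBy≡sort (x ∷ xs) = trans (insertBy≡insert x (sortBy c xs)) (cong (insert x) (sortBy≡sort xs))

  thenCmp-lt-inv : ∀ a r → thenCmp a r ≡ lt → (a ≡ lt) ⊎ (a ≡ eq × r ≡ lt)
  thenCmp-lt-inv lt r _ = inj₁ refl
  thenCmp-lt-inv eq r h = inj₂ (refl , h)
  thenCmp-lt-inv gt r ()

  thenCmp-eq-inv : ∀ a r → thenCmp a r ≡ eq → a ≡ eq × r ≡ eq
  thenCmp-eq-inv lt r ()
  thenCmp-eq-inv eq r h = refl , h
  thenCmp-eq-inv gt r ()

  thenCmp-eq : ∀ {a} r → a ≡ eq → thenCmp a r ≡ r
  thenCmp-eq r refl = refl

  thenCmp-lt : ∀ {a} r → a ≡ lt → thenCmp a r ≡ lt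
  thenCmp-lt r refl = refl

  lex-antisym : ∀ xs ys → lexCmp ys xs ≡ flipCmp (lexCmp xs ys)
  lex-antisym [] [] = refl
  lex-antisym [] (_ ∷ _) = refl
  lex-antisym (_ ∷ _) [] = refl
  lex-antisym (x ∷ xs) (y ∷ ys) = go (c x y) (c y x) refl refl (antisym x y)
    where
    go : ∀ a b → c x y ≡ a → c y x ≡ b → b ≡ flipCmp a → thenCmp b (lexCmp ys xs) ≡ flipCmp (thenCmp a (lexCmp xs ys))
    go lt .gt _ _ refl = refl
    go eq .eq _ _ refl = lex-antisym xs ys
    go gt .lt _ _ refl = refl

  lex-eq-substˡ : ∀ {xs ys} ≈Zsym → lexCmp xs ys ≡ eq → lexCmp xs ≈Zsym ≡ lexCmp ys ≈Zsym
  lex-eq-substˡ {[]} {[]} ≈Zsym h = refl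
  lex-eq-substˡ {[]} {_ ∷ _} ≈Zsym ()
  lex-eq-substˡ {_ ∷ _} {[]} ≈Zsym ()
  lex-eq-substˡ {x ∷ xs} {y ∷ ys} [] h = refl
  lex-eq-substˡ {x ∷ xs} {y ∷ ys} (z ∷ ≈Zsym) h with thenCmp-eq-inv (c x y) (lexCmp xs ys) h
  ... | e1 , e2 = trans (cong (λ a → thenCmp a (lexCmp xs ≈Zsym)) (eq-substˡ z e1)) (cong (thenCmp (c y z)) (lex-eq-substˡ {xs} {ys} ≈Zsym e2))

  lex-lt-trans : ∀ {xs ys ≈Zsym} → lexCmp xs ys ≡ lt → lexCmp ys ≈Zsym ≡ lt → lexCmp xs ≈Zsym ≡ lt
  lex-lt-trans {[]} {_ ∷ _} {_ ∷ _} h1 h2 = refl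
  lex-lt-trans {[]} {_ ∷ _} {[]} h1 ()
  lex-lt-trans {_ ∷ _} {[]} () h2
  lex-lt-trans {[]} {[]} () h2
  lex-lt-trans {x ∷ xs} {y ∷ ys} {[]} h1 ()
  lex-lt-trans {x ∷ xs} {y ∷ ys} {z ∷ ≈Zsym} h1 h2 with thenCmp-lt-inv (c x y) _ h1 | thenCmp-lt-inv (c y z) _ h2
  ... | inj₁ a | inj₁ b = cong (λ r → thenCmp r (lexCmp xs ≈Zsym)) (lt-trans a b)
  ... | inj₁ a | inj₂ (b , _) = cong (λ r → thenCmp r (lexCmp xs ≈Zsym)) (eq-transʳ b a)
  ... | inj₂ (a , _) | inj₁ b = cong (λ r → thenCmp r (lexCmp xs ≈Zsym)) (eq-transˡ a b)
  ... | inj₂ (a , a') | inj₂ (b , b') = trans (thenCmp-eq (lexCmp xs ≈Zsym) (eq-trans a b)) (lex-lt-trans {xs} {ys} {≈Zsym} a' b')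

  lexCmp-isComparison : IsComparison lexCmp
  lexCmp-isComparison = record { antisym = lex-antisym ; eq-substˡ = λ {x} {y} z e → lex-eq-substˡ {x} {y} z e ; lt-trans = λ {x} {y} {z} → lex-lt-trans {x} {y} {z} }

  module Lex = ComparisonProperties lexCmp-isComparison

  insert-cong-≯ : ∀ {x y} (s t : List X) {r} → r ≢ gt → c x y ≡ eq → lexCmp s t ≡ r → lexCmp (insert x s) (insert y t) ≡ r
  insert-cong-≯ {x} {y} [] [] n e h = trans (thenCmp-eq eq e) h
  insert-cong-≯ {x} {y} [] (z ∷ t) {r} n e h = trans (go (c y z) refl) h
    where
    go : ∀ b → c y z ≡ b → lexCmp (x ∷ []) (insertStep b y z t (insert y t)) ≡ lt
    go lt e2 = thenCmp-lt (lexCmp [] (insert y t)) (eq-transˡ e e2)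
    go eq e2 = thenCmp-eq lt e
    go gt e2 = thenCmp-eq lt e
  insert-cong-≯ (u ∷ s) [] n e h = ⊥-elim (n (sym h))
  insert-cong-≯ {x} {y} (u ∷ s) (z ∷ t) {r} n e h = go (c u z) (c x u) (c y z) refl refl refl h
    where
    go : ∀ a b1 b2 → c u z ≡ a → c x u ≡ b1 → c y z ≡ b2 → thenCmp a (lexCmp s t) ≡ r →
         lexCmp (insertStep b1 x u s (insert x s)) (insertStep b2 y z t (insert y t)) ≡ r
    go lt lt lt ea e1 e2 h' = trans (thenCmp-lt (lexCmp (insert x s) (insert y t)) ea) h'
    go lt lt eq ea e1 e2 h' = ⊥-elim (lt≢eq (trans (sym (eq-transˡ (eq-sym e) (lt-trans e1 ea))) e2))
    go lt lt gt ea e1 e2 h' = ⊥-elim (lt≢gt (trans (sym (eq-transˡ (eq-sym e) (lt-trans e1 ea))) e2))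
    go lt eq lt ea e1 e2 h' = trans (thenCmp-lt (lexCmp (u ∷ s) (insert y t)) (eq-transˡ e e2)) h'
    go lt gt lt ea e1 e2 h' = trans (thenCmp-lt (lexCmp (u ∷ s) (insert y t)) (eq-transˡ e e2)) h'
    go lt eq eq ea e1 e2 h' = trans (thenCmp-eq (thenCmp (c u z) (lexCmp s t)) e) (trans (thenCmp-lt (lexCmp s t) ea) h')
    go lt eq gt ea e1 e2 h' = trans (thenCmp-eq (thenCmp (c u z) (lexCmp s t)) e) (trans (thenCmp-lt (lexCmp s t) ea) h')
    go lt gt eq ea e1 e2 h' = trans (thenCmp-eq (thenCmp (c u z) (lexCmp s t)) e) (trans (thenCmp-lt (lexCmp s t) ea) h')
    go lt gt gt ea e1 e2 h' = trans (thenCmp-eq (thenCmp (c u z) (lexCmp s t)) e) (trans (thenCmp-lt (lexCmp s t) ea) h')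
    go eq lt lt ea e1 e2 h' = trans (thenCmp-eq (lexCmp (insert x s) (insert y t)) ea) (insert-cong-≯ s t n e h')
    go eq eq eq ea e1 e2 h' = trans (thenCmp-eq (thenCmp (c u z) (lexCmp s t)) e) (trans (thenCmp-eq (lexCmp s t) ea) h')
    go eq eq gt ea e1 e2 h' = trans (thenCmp-eq (thenCmp (c u z) (lexCmp s t)) e) (trans (thenCmp-eq (lexCmp s t) ea) h')
    go eq gt eq ea e1 e2 h' = trans (thenCmp-eq (thenCmp (c u z) (lexCmp s t)) e) (trans (thenCmp-eq (lexCmp s t) ea) h')
    go eq gt gt ea e1 e2 h' = trans (thenCmp-eq (thenCmp (c u z) (lexCmp s t)) e) (trans (thenCmp-eq (lexCmp s t) ea) h')
    go eq lt eq ea e1 e2 h' = ⊥-elim (lt≢eq (trans (sym e1) (trans (eq-cong₂ e ea) e2)))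
    go eq lt gt ea e1 e2 h' = ⊥-elim (lt≢gt (trans (sym e1) (trans (eq-cong₂ e ea) e2)))
    go eq eq lt ea e1 e2 h' = ⊥-elim (eq≢lt (trans (sym e1) (trans (eq-cong₂ e ea) e2)))
    go eq gt lt ea e1 e2 h' = ⊥-elim (gt≢lt (trans (sym e1) (trans (eq-cong₂ e ea) e2)))
    go gt b1 b2 ea e1 e2 h' = ⊥-elim (n (sym h'))

  insert-cong : ∀ {x y} (s t : List X) → c x y ≡ eq → lexCmp (insert x s) (insert y t) ≡ lexCmp s t
  insert-cong {x} {y} s t e with lexCmp s t in h
  ... | lt = insert-cong-≯ s t lt≢gt e h
  ... | eq = insert-cong-≯ s t eq≢gt e h
  ... | gt = Lex.lt⇒swap-gt {insert y t} {insert x s} (insert-cong-≯ t s lt≢gt (eq-sym e) (Lex.gt⇒swap-lt {s} {t} h))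

  insert-lt : ∀ {x y ys} → c x y ≡ lt → insert x (y ∷ ys) ≡ y ∷ insert x ys
  insert-lt e rewrite e = refl

  antisym-inv : ∀ {x y a b} → c x y ≡ a → c y x ≡ b → b ≡ flipCmp a
  antisym-inv {x} {y} e1 e2 = trans (sym e2) (trans (antisym x y) (cong flipCmp e1))

  insert-≮ : ∀ {x y ys} → c x y ≢ lt → insert x (y ∷ ys) ≡ x ∷ y ∷ ys
  insert-≮ {x} {y} n with c x y
  ... | lt = ⊥-elim (n refl)
  ... | eq = refl
  ... | gt = refl

  lt-≮⇒lt : ∀ {x y z} → c y z ≡ lt → c x z ≢ lt → c y x ≡ lt
  lt-≮⇒lt e n = lt-≤-trans e (≮⇒swap-≯ n)

  insert-comm-≮-≮ : ∀ {x y z s} → c y z ≢ lt → c x z ≢ lt →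
    lexCmp (insertStep (c x y) x y (z ∷ s) (x ∷ z ∷ s)) (insertStep (c y x) y x (z ∷ s) (insert y (z ∷ s))) ≡ eq
  insert-comm-≮-≮ {x} {y} {z} {s} n1 n2 with c x y in d | c y x in d'
  ... | lt | gt = Lex.eq-refl (y ∷ x ∷ z ∷ s)
  ... | gt | lt rewrite insert-≮ {y} {z} {s} n1 = Lex.eq-refl (x ∷ y ∷ z ∷ s)
  ... | eq | eq = trans (thenCmp-eq _ d) (trans (thenCmp-eq _ d') (Lex.eq-refl (z ∷ s)))
  ... | lt | lt with () ← antisym-inv d d'
  ... | lt | eq with () ← antisym-inv d d'
  ... | eq | lt with () ← antisym-inv d d'
  ... | eq | gt with () ← antisym-inv d d'
  ... | gt | eq with () ← antisym-inv d d'
  ... | gt | gt with () ← antisym-inv d d'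

  insert-comm-lt-≮ : ∀ {x y z s} → c y z ≡ lt → c x z ≢ lt →
    lexCmp (x ∷ z ∷ insert y s) (insert y (x ∷ z ∷ s)) ≡ eq
  insert-comm-lt-≮ {x} {y} {z} {s} ea n rewrite insert-lt {y} {x} {z ∷ s} (lt-≮⇒lt ea n) | insert-lt {y} {z} {s} ea = Lex.eq-refl (x ∷ z ∷ insert y s)

  insert-comm-≮-lt : ∀ {x y z s} → c y z ≢ lt → c x z ≡ lt →
    lexCmp (insertStep (c x y) x y (z ∷ s) (z ∷ insert x s)) (insert y (z ∷ insert x s)) ≡ eq
  insert-comm-≮-lt {x} {y} {z} {s} n eb with c x y in e
  ... | lt rewrite insert-≮ {y} {z} {insert x s} n = Lex.eq-refl (y ∷ z ∷ insert x s)
  ... | eq with () ← trans (sym e) (lt-≮⇒lt eb n)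
  ... | gt with () ← trans (sym e) (lt-≮⇒lt eb n)

  insert-comm : ∀ x y s → lexCmp (insert x (insert y s)) (insert y (insert x s)) ≡ eq
  insert-comm x y [] with c x y in e1 | c y x in e2
  ... | lt | gt = Lex.eq-refl (y ∷ x ∷ [])
  ... | gt | lt = Lex.eq-refl (x ∷ y ∷ [])
  ... | eq | eq = trans (thenCmp-eq (thenCmp (c y x) eq) e1) (thenCmp-eq eq e2)
  ... | lt | lt with () ← antisym-inv e1 e2
  ... | lt | eq with () ← antisym-inv e1 e2
  ... | eq | lt with () ← antisym-inv e1 e2
  ... | eq | gt with () ← antisym-inv e1 e2
  ... | gt | eq with () ← antisym-inv e1 e2
  ... | gt | gt with () ← antisym-inv e1 e2
  insert-comm x y (z ∷ s) with c y z in ea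
  ... | lt with c x z in eb
  ...   | lt rewrite ea = trans (thenCmp-eq (lexCmp (insert x (insert y s)) (insert y (insert x s))) (eq-refl z)) (insert-comm x y s)
  ...   | eq = insert-comm-lt-≮ ea (λ h → eq≢lt (trans (sym eb) h))
  ...   | gt = insert-comm-lt-≮ ea (λ h → gt≢lt (trans (sym eb) h))
  insert-comm x y (z ∷ s) | eq with c x z in eb
  ...   | lt = insert-comm-≮-lt (λ h → eq≢lt (trans (sym ea) h)) eb
  ...   | eq = insert-comm-≮-≮ (λ h → eq≢lt (trans (sym ea) h)) (λ h → eq≢lt (trans (sym eb) h))
  ...   | gt = insert-comm-≮-≮ (λ h → eq≢lt (trans (sym ea) h)) (λ h → gt≢lt (trans (sym eb) h))
  insert-comm x y (z ∷ s) | gt with c x z in eb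
  ...   | lt = insert-comm-≮-lt (λ h → gt≢lt (trans (sym ea) h)) eb
  ...   | eq = insert-comm-≮-≮ (λ h → gt≢lt (trans (sym ea) h)) (λ h → eq≢lt (trans (sym eb) h))
  ...   | gt = insert-comm-≮-≮ (λ h → gt≢lt (trans (sym ea) h)) (λ h → gt≢lt (trans (sym eb) h))

  sort-↭-eq : ∀ {l m} → l ↭ m → lexCmp (sort l) (sort m) ≡ eq
  sort-↭-eq {l} Perm.refl = Lex.eq-refl (sort l)
  sort-↭-eq {x ∷ l} {.x ∷ m} (Perm.prep x p) = trans (insert-cong (sort l) (sort m) (eq-refl x)) (sort-↭-eq p)
  sort-↭-eq {x ∷ y ∷ l} {.y ∷ .x ∷ m} (Perm.swap .x .y p) =
    Lex.eq-trans {insert x (insert y (sort l))} {insert x (insert y (sort m))} {insert y (insert x (sort m))}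
      (trans (insert-cong (insert y (sort l)) (insert y (sort m)) (eq-refl x)) (trans (insert-cong (sort l) (sort m) (eq-refl y)) (sort-↭-eq p))) (insert-comm x y (sort m))
  sort-↭-eq {l} {m} (Perm.trans {ys = k} p q) = Lex.eq-trans {sort l} {sort k} {sort m} (sort-↭-eq p) (sort-↭-eq q)

  insert-↭ : ∀ x s → insert x s ↭ x ∷ s
  insert-↭ x [] = ↭-refl
  insert-↭ x (y ∷ s) with c x y
  ... | lt = ↭-trans (prep y (insert-↭ x s)) (swap y x ↭-refl)
  ... | eq = ↭-refl
  ... | gt = ↭-refl

  sort-↭ : ∀ l → sort l ↭ l
  sort-↭ [] = ↭-refl
  sort-↭ (x ∷ l) = ↭-trans (insert-↭ x (sort l)) (prep x (sort-↭ l))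

  lex-eq-++ʳ : ∀ {p p'} q → lexCmp p p' ≡ eq → lexCmp (p ++ q) (p' ++ q) ≡ eq
  lex-eq-++ʳ {[]} {[]} q h = Lex.eq-refl q
  lex-eq-++ʳ {[]} {_ ∷ _} q ()
  lex-eq-++ʳ {_ ∷ _} {[]} q ()
  lex-eq-++ʳ {x ∷ p} {y ∷ p'} q h with thenCmp-eq-inv (c x y) _ h
  ... | e1 , e2 = trans (thenCmp-eq (lexCmp (p ++ q) (p' ++ q)) e1) (lex-eq-++ʳ {p} {p'} q e2)

  sort-lex-eq : ∀ {l m} → lexCmp l m ≡ eq → lexCmp (sort l) (sort m) ≡ eq
  sort-lex-eq {[]} {[]} h = refl
  sort-lex-eq {[]} {_ ∷ _} ()
  sort-lex-eq {_ ∷ _} {[]} ()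
  sort-lex-eq {x ∷ l} {y ∷ m} h with thenCmp-eq-inv (c x y) _ h
  ... | e1 , e2 = trans (insert-cong (sort l) (sort m) e1) (sort-lex-eq {l} {m} e2)

  msCmp : List X → List X → Cmp
  msCmp a b = lexCmp (sort a) (sort b)

  msCmp-isComparison : IsComparison msCmp
  msCmp-isComparison = IsComparison-on sort lexCmp-isComparison

  module Ms = ComparisonProperties msCmp-isComparison

  msCmp-++ˡ : ∀ u l m → msCmp (u ++ l) (u ++ m) ≡ msCmp l m
  msCmp-++ˡ [] l m = refl
  msCmp-++ˡ (x ∷ u) l m = trans (insert-cong (sort (u ++ l)) (sort (u ++ m)) (eq-refl x)) (msCmp-++ˡ u l m)

  msCmp-↭ : ∀ {l m} → l ↭ m → msCmp l m ≡ eq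
  msCmp-↭ = sort-↭-eq

  msCmp-++-comm : ∀ l m → msCmp (l ++ m) (m ++ l) ≡ eq
  msCmp-++-comm l m = sort-↭-eq (++-comm l m)

  msCmp-++ʳ : ∀ u l m → msCmp (l ++ u) (m ++ u) ≡ msCmp l m
  msCmp-++ʳ u l m = trans (Ms.eq-cong₂ {l ++ u} {u ++ l} {m ++ u} {u ++ m} (msCmp-++-comm l u) (msCmp-++-comm m u)) (msCmp-++ˡ u l m)

  msCmp-[]-≯ : ∀ l → msCmp [] l ≢ gt
  msCmp-[]-≯ l h with sort l
  ... | [] = eq≢gt h
  ... | _ ∷ _ = lt≢gt h

  All-insert : ∀ {Q : X → Set} {x} s → Q x → All Q s → All Q (insert x s)
  All-insert [] qx _ = qx ∷ []
  All-insert {x = x} (y ∷ s) qx (qy ∷ qs) with c x y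
  ... | lt = qy ∷ All-insert s qx qs
  ... | eq = qx ∷ qy ∷ qs
  ... | gt = qx ∷ qy ∷ qs

  insert-lt-singleton : ∀ {x z} s → lexCmp s (z ∷ []) ≡ lt → c x z ≡ lt → lexCmp (insert x s) (z ∷ []) ≡ lt
  insert-lt-singleton {x} {z} [] h e = thenCmp-lt eq e
  insert-lt-singleton {x} {z} (h ∷ s) hh e with thenCmp-lt-inv (c h z) _ hh | c x h
  ... | inj₁ e' | lt = thenCmp-lt _ e'
  ... | inj₁ e' | eq = thenCmp-lt _ e
  ... | inj₁ e' | gt = thenCmp-lt _ e
  ... | inj₂ (_ , e') | _ with s
  ...   | [] = ⊥-elim (eq≢lt e')
  ...   | _ ∷ _ = ⊥-elim (gt≢lt e')

  sort-lt-singleton : ∀ {z} u → All (λ x → c x z ≡ lt) u → lexCmp (sort u) (z ∷ []) ≡ lt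
  sort-lt-singleton [] _ = refl
  sort-lt-singleton (x ∷ u) (e ∷ es) = insert-lt-singleton (sort u) (sort-lt-singleton u es) e

  msCmp-all-lt : ∀ {z} u w → All (λ x → c x z ≡ lt) u → msCmp u (z ∷ w) ≡ lt
  msCmp-all-lt {z} u w a = Ms.lt-≤-trans {u} {z ∷ []} {z ∷ w} (sort-lt-singleton u a)
    (λ h → msCmp-[]-≯ w (trans (sym (msCmp-++ˡ (z ∷ []) [] w)) h))

  Sorted : List X → Set
  Sorted [] = ⊤
  Sorted (x ∷ l) = All (λ y → c y x ≢ gt) l × Sorted l

  insert-sorted : ∀ {x} s → Sorted s → Sorted (insert x s)
  insert-sorted [] _ = [] , tt
  insert-sorted {x} (y ∷ s) (ay , sy) with c x y in e
  ... | lt = All-insert s (λ h → lt≢gt (trans (sym e) h)) ay , insert-sorted s sy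
  ... | eq = (≮⇒swap-≯ (λ h → eq≢lt (trans (sym e) h)) ∷ AllM.map (λ h → ≤-≤-trans h (≮⇒swap-≯ (λ h → eq≢lt (trans (sym e) h)))) ay) , (ay , sy)
  ... | gt = (≮⇒swap-≯ (λ h → gt≢lt (trans (sym e) h)) ∷ AllM.map (λ h → ≤-≤-trans h (≮⇒swap-≯ (λ h → gt≢lt (trans (sym e) h)))) ay) , (ay , sy)

  sort-sorted : ∀ l → Sorted (sort l)
  sort-sorted [] = tt
  sort-sorted (x ∷ l) = insert-sorted (sort l) (sort-sorted l)

  record LexLtSplit (S T : List X) : Set where
    field
      p p' U W : List X
      y : X
      eS : S ≡ p ++ U
      eT : T ≡ p' ++ y ∷ W
      pp : lexCmp p p' ≡ eq
      allU : All (λ x → c x y ≡ lt) U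
      allW : All (λ x → c x y ≢ gt) W

  lexLtSplit : ∀ S T → Sorted S → Sorted T → lexCmp S T ≡ lt → LexLtSplit S T
  lexLtSplit [] (y ∷ W) _ (aw , _) h = record { p = [] ; p' = [] ; U = [] ; W = W ; y = y ; eS = refl ; eT = refl ; pp = refl ; allU = [] ; allW = aw }
  lexLtSplit [] [] _ _ ()
  lexLtSplit (_ ∷ _) [] _ _ ()
  lexLtSplit (x ∷ S) (y₀ ∷ T) (ax , sS) (ay , sT) h with thenCmp-lt-inv (c x y₀) _ h
  ... | inj₁ e = record { p = [] ; p' = [] ; U = x ∷ S ; W = T ; y = y₀ ; eS = refl ; eT = refl ; pp = refl
                        ; allU = e ∷ AllM.map (λ n → ≤-lt-trans n e) ax ; allW = ay }
  ... | inj₂ (e , h') = let open LexLtSplit (lexLtSplit S T sS sT h') in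
     record { p = x ∷ p ; p' = y₀ ∷ p' ; U = U ; W = W ; y = y ; eS = cong (x ∷_) eS ; eT = cong (y₀ ∷_) eT
            ; pp = trans (thenCmp-eq _ e) pp ; allU = allU ; allW = allW }

  msCmp-sort : ∀ a → msCmp a (sort a) ≡ eq
  msCmp-sort a = sort-↭-eq (↭-sym (sort-↭ a))

  record MsLtSplit (a b : List X) : Set where
    field
      p U W : List X
      y : X
      ea : msCmp a (p ++ U) ≡ eq
      eb : msCmp b (p ++ y ∷ W) ≡ eq
      allU : All (λ x → c x y ≡ lt) U
      allW : All (λ x → c x y ≢ gt) W

  msLtSplit : ∀ a b → msCmp a b ≡ lt → MsLtSplit a b
  msLtSplit a b h = let open LexLtSplit (lexLtSplit (sort a) (sort b) (sort-sorted a) (sort-sorted b) h) in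
    record { p = p ; U = U ; W = W ; y = y
           ; ea = subst (λ q → msCmp a q ≡ eq) eS (msCmp-sort a)
           ; eb = Ms.eq-trans {b} {sort b} {p ++ y ∷ W} (msCmp-sort b)
                    (subst (λ q → msCmp q (p ++ y ∷ W) ≡ eq) (sym eT) (sort-lex-eq {p' ++ y ∷ W} {p ++ y ∷ W} (lex-eq-++ʳ {p'} {p} (y ∷ W) (Lex.eq-sym {p} {p'} pp))))
           ; allU = allU ; allW = allW }

module Naturals (α : Ordinal) where
  open import Level using (0ℓ)
  open Comparison
  open import Data.List using (List; []; _∷_; _++_; map; concatMap)
  import Data.List.Properties as LP
  open import Data.List.Relation.Unary.All using (All; []; _∷_)
  import Data.List.Relation.Unary.All as AllM
  import Data.List.Relation.Unary.All.Properties as AllP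
  open import Data.List.Relation.Binary.Permutation.Propositional as Perm using (_↭_; prep; swap; ↭-sym; ↭-trans; ↭-refl; ↭-reflexive)
  open import Data.List.Relation.Binary.Permutation.Propositional.Properties using (++⁺ˡ; ++⁺; shifts)
  import Data.List.Relation.Binary.Permutation.Propositional.Properties as PermP
  open import Data.Product using (_,_)
  open import Data.Empty using (⊥-elim)
  open import Relation.Binary.PropositionalEquality
  open import Relation.Binary using (IsStrictTotalOrder; tri<; tri≈; tri>)
  open import Algebra.Structures
  open import Algebra.Structures.Biased
  open import Algebra.Bundles
  import Algebra.Solver.Ring.NaturalCoefficients.Default

  open Arith α
  open Ordinal α using (isStrictTotalOrder) renaming (Carrier to Ob; _<_ to _<o_)
  open IsStrictTotalOrder isStrictTotalOrder using (compare; asym; irrefl) renaming (trans to <trans)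

  cmpOb-antisym : ∀ x y → cmpOb y x ≡ flipCmp (cmpOb x y)
  cmpOb-antisym x y with compare x y | compare y x
  ... | tri< a _ _ | tri< b _ _ = ⊥-elim (asym a b)
  ... | tri< a _ _ | tri≈ _ e _ = ⊥-elim (irrefl (sym e) a)
  ... | tri< a _ _ | tri> _ _ _ = refl
  ... | tri≈ _ e _ | tri< b _ _ = ⊥-elim (irrefl (sym e) b)
  ... | tri≈ _ e _ | tri≈ _ _ _ = refl
  ... | tri≈ _ e _ | tri> _ _ c = ⊥-elim (irrefl e c)
  ... | tri> _ _ c | tri< _ _ _ = refl
  ... | tri> _ _ c | tri≈ _ e _ = ⊥-elim (irrefl e c)
  ... | tri> _ _ c | tri> _ _ d = ⊥-elim (asym c d)

  cmpOb-eq : ∀ {x y} → cmpOb x y ≡ eq → x ≡ y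
  cmpOb-eq {x} {y} h with compare x y
  ... | tri≈ _ e _ = e
  cmpOb-eq {x} {y} () | tri< _ _ _
  cmpOb-eq {x} {y} () | tri> _ _ _

  cmpOb-lt : ∀ {x y} → cmpOb x y ≡ lt → x <o y
  cmpOb-lt {x} {y} h with compare x y
  ... | tri< a _ _ = a
  cmpOb-lt {x} {y} () | tri≈ _ _ _
  cmpOb-lt {x} {y} () | tri> _ _ _

  <⇒cmpOb-lt : ∀ {x y} → x <o y → cmpOb x y ≡ lt
  <⇒cmpOb-lt {x} {y} h with compare x y
  ... | tri< _ _ _ = refl
  ... | tri≈ _ e _ = ⊥-elim (irrefl e h)
  ... | tri> _ _ c = ⊥-elim (asym h c)

  cmpOb-isComparison : IsComparison cmpOb
  cmpOb-isComparison = record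
    { antisym = cmpOb-antisym
    ; eq-substˡ = λ {x} {y} z e → cong (λ w → cmpOb w z) (cmpOb-eq e)
    ; lt-trans = λ e1 e2 → <⇒cmpOb-lt (<trans (cmpOb-lt e1) (cmpOb-lt e2)) }

  module ExpOrder = MultisetOrder cmpOb cmpOb-isComparison

  normE≡sort : ∀ e → normE e ≡ ExpOrder.sort e
  normE≡sort e = ExpOrder.sortBy≡sort e

  cmpE≡msCmp : ∀ e f → cmpE e f ≡ ExpOrder.msCmp e f
  cmpE≡msCmp e f = trans (ExpOrder.cmpList≡lexCmp (normE e) (normE f)) (cong₂ ExpOrder.lexCmp (normE≡sort e) (normE≡sort f))

  cmpE-isComparison : IsComparison cmpE
  cmpE-isComparison = IsComparison-ext (λ x y → sym (cmpE≡msCmp x y)) ExpOrder.msCmp-isComparison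

  module CmpE = ComparisonProperties cmpE-isComparison

  cmpE-++ˡ : ∀ u e f → cmpE (u ++ e) (u ++ f) ≡ cmpE e f
  cmpE-++ˡ u e f = trans (cmpE≡msCmp (u ++ e) (u ++ f)) (trans (ExpOrder.msCmp-++ˡ u e f) (sym (cmpE≡msCmp e f)))

  cmpE-++ʳ : ∀ u e f → cmpE (e ++ u) (f ++ u) ≡ cmpE e f
  cmpE-++ʳ u e f = trans (cmpE≡msCmp (e ++ u) (f ++ u)) (trans (ExpOrder.msCmp-++ʳ u e f) (sym (cmpE≡msCmp e f)))

  cmpE-++-comm : ∀ e f → cmpE (e ++ f) (f ++ e) ≡ eq
  cmpE-++-comm e f = trans (cmpE≡msCmp (e ++ f) (f ++ e)) (ExpOrder.msCmp-++-comm e f)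

  cmpE-normE : ∀ e → cmpE (normE e) e ≡ eq
  cmpE-normE e = trans (cmpE≡msCmp (normE e) e) (trans (cong (λ q → ExpOrder.msCmp q e) (normE≡sort e)) (ExpOrder.Ms.eq-sym {e} {ExpOrder.sort e} (ExpOrder.msCmp-sort e)))

  module NOrder = MultisetOrder cmpE cmpE-isComparison

  compareN : N → N → Cmp
  compareN = NOrder.msCmp

  module CmpN = ComparisonProperties NOrder.msCmp-isComparison

  map-normE-lex-eq : ∀ a → NOrder.lexCmp (map normE a) a ≡ eq
  map-normE-lex-eq [] = refl
  map-normE-lex-eq (e ∷ a) = trans (NOrder.thenCmp-eq (NOrder.lexCmp (map normE a) a) (cmpE-normE e)) (map-normE-lex-eq a)

  cmpN≡compareN : ∀ a b → cmpN a b ≡ compareN a b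
  cmpN≡compareN a b = trans (NOrder.cmpList≡lexCmp (normN a) (normN b))
     (trans (cong₂ NOrder.lexCmp (NOrder.sortBy≡sort (map normE a)) (NOrder.sortBy≡sort (map normE b)))
       (CmpN.eq-cong₂ {map normE a} {a} {map normE b} {b} (NOrder.sort-lex-eq {map normE a} {a} (map-normE-lex-eq a)) (NOrder.sort-lex-eq {map normE b} {b} (map-normE-lex-eq b))))

  tensor : (Exp → Exp → Exp) → N → N → N
  tensor g a b = concatMap (λ e → map (g e) b) a

  concatMap-↭ : ∀ {A B : Set} (g : A → List B) {l m} → l ↭ m → concatMap g l ↭ concatMap g m
  concatMap-↭ g Perm.refl = ↭-refl
  concatMap-↭ g (Perm.prep x p) = ++⁺ˡ (g x) (concatMap-↭ g p)
  concatMap-↭ g (Perm.swap x y p) = ↭-trans (shifts (g x) (g y)) (++⁺ˡ (g y) (++⁺ˡ (g x) (concatMap-↭ g p)))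
  concatMap-↭ g (Perm.trans p q) = ↭-trans (concatMap-↭ g p) (concatMap-↭ g q)

  concatMap-const-[] : ∀ {A B : Set} (l : List A) → concatMap {B = B} (λ _ → []) l ≡ []
  concatMap-const-[] [] = refl
  concatMap-const-[] (x ∷ l) = concatMap-const-[] l

  concatMap-∷-↭ : ∀ {A B : Set} (h : A → B) (k : A → List B) b → concatMap (λ f → h f ∷ k f) b ↭ map h b ++ concatMap k b
  concatMap-∷-↭ h k [] = ↭-refl
  concatMap-∷-↭ h k (f ∷ b) = prep (h f) (↭-trans (++⁺ˡ (k f) (concatMap-∷-↭ h k b)) (shifts (k f) (map h b)))

  tensor-transpose : ∀ (g : Exp → Exp → Exp) a b → tensor g a b ↭ tensor (λ f e → g e f) b a
  tensor-transpose g [] b = ↭-reflexive (sym (concatMap-const-[] b))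
  tensor-transpose g (e ∷ a) b = ↭-trans (++⁺ˡ (map (g e) b) (tensor-transpose g a b)) (↭-sym (concatMap-∷-↭ (λ f → g e f) (λ f → map (λ e' → g e' f) a) b))

  lex-eq-++ : ∀ {p p' q q'} → NOrder.lexCmp p p' ≡ eq → NOrder.lexCmp q q' ≡ eq → NOrder.lexCmp (p ++ q) (p' ++ q') ≡ eq
  lex-eq-++ {[]} {[]} h1 h2 = h2
  lex-eq-++ {[]} {_ ∷ _} () h2
  lex-eq-++ {_ ∷ _} {[]} () h2
  lex-eq-++ {x ∷ p} {y ∷ p'} {q} {q'} h1 h2 with NOrder.thenCmp-eq-inv (cmpE x y) _ h1
  ... | e1 , e2 = trans (NOrder.thenCmp-eq (NOrder.lexCmp (p ++ q) (p' ++ q')) e1) (lex-eq-++ {p} {p'} {q} {q'} e2 h2)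

  lex-eq-map : ∀ (g h : Exp → Exp) l → (∀ x → cmpE (g x) (h x) ≡ eq) → NOrder.lexCmp (map g l) (map h l) ≡ eq
  lex-eq-map g h [] H = refl
  lex-eq-map g h (x ∷ l) H = trans (NOrder.thenCmp-eq (NOrder.lexCmp (map g l) (map h l)) (H x)) (lex-eq-map g h l H)

  tensor-lex-eq : ∀ g h a b → (∀ x y → cmpE (g x y) (h x y) ≡ eq) → NOrder.lexCmp (tensor g a b) (tensor h a b) ≡ eq
  tensor-lex-eq g h [] b H = refl
  tensor-lex-eq g h (e ∷ a) b H = lex-eq-++ {map (g e) b} {map (h e) b} {tensor g a b} {tensor h a b} (lex-eq-map (g e) (h e) b (H e)) (tensor-lex-eq g h a b H)

  ⊗-comm : ∀ a b → compareN (a ⊗ b) (b ⊗ a) ≡ eq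
  ⊗-comm a b = CmpN.eq-trans {a ⊗ b} {tensor (λ f e → e ++ f) b a} {b ⊗ a} (NOrder.msCmp-↭ (tensor-transpose _++_ a b))
                 (NOrder.sort-lex-eq {tensor (λ f e → e ++ f) b a} {b ⊗ a} (tensor-lex-eq (λ f e → e ++ f) _++_ b a (λ f e → cmpE-++-comm e f)))

  ⊗-lex-eqˡ : ∀ {l l'} b → NOrder.lexCmp l l' ≡ eq → NOrder.lexCmp (l ⊗ b) (l' ⊗ b) ≡ eq
  ⊗-lex-eqˡ {[]} {[]} b h = refl
  ⊗-lex-eqˡ {[]} {_ ∷ _} b ()
  ⊗-lex-eqˡ {_ ∷ _} {[]} b ()
  ⊗-lex-eqˡ {x ∷ l} {y ∷ l'} b h with NOrder.thenCmp-eq-inv (cmpE x y) _ h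
  ... | e1 , e2 = lex-eq-++ {map (x ++_) b} {map (y ++_) b} {l ⊗ b} {l' ⊗ b}
                    (lex-eq-map (x ++_) (y ++_) b (λ f → trans (cmpE-++ʳ f x y) e1)) (⊗-lex-eqˡ {l} {l'} b e2)

  ⊗-↭ˡ : ∀ {a a'} b → a ↭ a' → a ⊗ b ↭ a' ⊗ b
  ⊗-↭ˡ b p = concatMap-↭ (λ e → map (e ++_) b) p

  ⊗-congL : ∀ a a' b → compareN a a' ≡ eq → compareN (a ⊗ b) (a' ⊗ b) ≡ eq
  ⊗-congL a a' b h =
    CmpN.eq-trans {a ⊗ b} {NOrder.sort a ⊗ b} {a' ⊗ b} (NOrder.msCmp-↭ (⊗-↭ˡ b (↭-sym (NOrder.sort-↭ a))))
      (CmpN.eq-trans {NOrder.sort a ⊗ b} {NOrder.sort a' ⊗ b} {a' ⊗ b}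
        (NOrder.sort-lex-eq {NOrder.sort a ⊗ b} {NOrder.sort a' ⊗ b} (⊗-lex-eqˡ {NOrder.sort a} {NOrder.sort a'} b h))
        (NOrder.msCmp-↭ (⊗-↭ˡ b (NOrder.sort-↭ a'))))

  ⊗-congR : ∀ a b b' → compareN b b' ≡ eq → compareN (a ⊗ b) (a ⊗ b') ≡ eq
  ⊗-congR a b b' h = CmpN.eq-trans {a ⊗ b} {b ⊗ a} {a ⊗ b'} (⊗-comm a b)
     (CmpN.eq-trans {b ⊗ a} {b' ⊗ a} {a ⊗ b'} (⊗-congL b b' a h) (⊗-comm b' a))

  ⊗-distribʳ : ∀ a b c → (a ++ b) ⊗ c ≡ (a ⊗ c) ++ (b ⊗ c)
  ⊗-distribʳ a b c = LP.concatMap-++ (λ e → map (e ++_) c) a b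

  ⊗-map-++ : ∀ e b c → (map (e ++_) b) ⊗ c ≡ map (e ++_) (b ⊗ c)
  ⊗-map-++ e [] c = refl
  ⊗-map-++ e (f ∷ b) c = trans (cong₂ _++_ (trans (LP.map-cong (λ g → LP.++-assoc e f g) c) (LP.map-∘ c)) (⊗-map-++ e b c))
                             (sym (LP.map-++ (e ++_) (map (f ++_) c) (b ⊗ c)))

  ⊗-assoc : ∀ a b c → (a ⊗ b) ⊗ c ≡ a ⊗ (b ⊗ c)
  ⊗-assoc [] b c = refl
  ⊗-assoc (e ∷ a) b c = trans (⊗-distribʳ (map (e ++_) b) (a ⊗ b) c) (cong₂ _++_ (⊗-map-++ e b c) (⊗-assoc a b c))

  ⊗-identityʳ : ∀ a → a ⊗ ([] ∷ []) ≡ a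
  ⊗-identityʳ [] = refl
  ⊗-identityʳ (e ∷ a) = cong₂ _∷_ (LP.++-identityʳ e) (⊗-identityʳ a)

  record _≈N_ (a b : N) : Set where
    constructor ≈N⟨_⟩
    field un≈N : compareN a b ≡ eq
  open _≈N_ public

  ≈Nrefl : ∀ {a} → a ≈N a
  ≈Nrefl {a} = ≈N⟨ CmpN.eq-refl a ⟩

  ≈Nsym : ∀ {a b} → a ≈N b → b ≈N a
  ≈Nsym {a} {b} ≈N⟨ h ⟩ = ≈N⟨ CmpN.eq-sym {a} {b} h ⟩

  ≈Ntrans : ∀ {a b c} → a ≈N b → b ≈N c → a ≈N c
  ≈Ntrans {a} {b} {c} ≈N⟨ h ⟩ ≈N⟨ k ⟩ = ≈N⟨ CmpN.eq-trans {a} {b} {c} h k ⟩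

  ≡⇒≈N : ∀ {a b} → a ≡ b → a ≈N b
  ≡⇒≈N {a} refl = ≈Nrefl

  ++-cong : ∀ {a a' b b'} → a ≈N a' → b ≈N b' → (a ++ b) ≈N (a' ++ b')
  ++-cong {a} {a'} {b} {b'} ≈N⟨ h1 ⟩ ≈N⟨ h2 ⟩ = ≈N⟨ CmpN.eq-trans {a ++ b} {a' ++ b} {a' ++ b'} (trans (NOrder.msCmp-++ʳ b a a') h1) (trans (NOrder.msCmp-++ˡ a' b b') h2) ⟩

  ⊗-cong : ∀ {a a' b b'} → a ≈N a' → b ≈N b' → (a ⊗ b) ≈N (a' ⊗ b')
  ⊗-cong {a} {a'} {b} {b'} ≈N⟨ h1 ⟩ ≈N⟨ h2 ⟩ = ≈N⟨ CmpN.eq-trans {a ⊗ b} {a' ⊗ b} {a' ⊗ b'} (⊗-congL a a' b h1) (⊗-congR a' b b' h2) ⟩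

  ++-isCommutativeMonoid : IsCommutativeMonoid _≈N_ _++_ []
  ++-isCommutativeMonoid = record
    { isMonoid = record
      { isSemigroup = record
        { isMagma = record
          { isEquivalence = record { refl = ≈Nrefl ; sym = ≈Nsym ; trans = ≈Ntrans }
          ; ∙-cong = ++-cong }
        ; assoc = λ x y z → ≡⇒≈N (LP.++-assoc x y z) }
      ; identity = (λ x → ≈Nrefl) , (λ x → ≡⇒≈N (LP.++-identityʳ x)) }
    ; comm = λ x y → ≈N⟨ NOrder.msCmp-++-comm x y ⟩ }

  ⊗-isCommutativeMonoid : IsCommutativeMonoid _≈N_ _⊗_ ([] ∷ [])
  ⊗-isCommutativeMonoid = record
    { isMonoid = record
      { isSemigroup = record
        { isMagma = record
          { isEquivalence = record { refl = ≈Nrefl ; sym = ≈Nsym ; trans = ≈Ntrans }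
          ; ∙-cong = ⊗-cong }
        ; assoc = λ x y z → ≡⇒≈N (⊗-assoc x y z) }
      ; identity = (λ x → ≈Ntrans ≈N⟨ ⊗-comm ([] ∷ []) x ⟩ (≡⇒≈N (⊗-identityʳ x))) , (λ x → ≡⇒≈N (⊗-identityʳ x)) }
    ; comm = λ x y → ≈N⟨ ⊗-comm x y ⟩ }

  ++-⊗-isCommutativeSemiring : IsCommutativeSemiring _≈N_ _++_ _⊗_ [] ([] ∷ [])
  ++-⊗-isCommutativeSemiring = IsCommutativeSemiringˡ.isCommutativeSemiring (record
    { +-isCommutativeMonoid = ++-isCommutativeMonoid
    ; *-isCommutativeMonoid = ⊗-isCommutativeMonoid
    ; distribʳ = λ x y z → ≡⇒≈N (⊗-distribʳ y z x)
    ; zeroˡ = λ x → ≈Nrefl })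

  ++-⊗-commutativeSemiring : CommutativeSemiring 0ℓ 0ℓ
  ++-⊗-commutativeSemiring = record { isCommutativeSemiring = ++-⊗-isCommutativeSemiring }

  module NSolver = Algebra.Solver.Ring.NaturalCoefficients.Default ++-⊗-commutativeSemiring
  open NSolver public using (solve; _:+_; _:*_; _:=_)

  ≈N-intro : ∀ a b → compareN a b ≡ eq → a ≈N b
  ≈N-intro a b h = ≈N⟨ h ⟩

  All-⊗ : ∀ {P Q R : Exp → Set} es fs → All P es → All Q fs → (∀ {e f} → P e → Q f → R (e ++ f)) → All R (es ⊗ fs)
  All-⊗ [] fs _ _ H = []
  All-⊗ {R = R} (e ∷ es) fs (pe ∷ pes) qfs H = AllP.++⁺ (AllP.map⁺ {P = R} {f = e ++_} (AllM.map (H pe) qfs)) (All-⊗ es fs pes qfs H)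

  -- In ℤ_α this says that a product of positive elements is positive.
  cross-< : ∀ a b c d → compareN b a ≡ lt → compareN d c ≡ lt → compareN ((a ⊗ d) ++ (b ⊗ c)) ((a ⊗ c) ++ (b ⊗ d)) ≡ lt
  cross-< a b c d h1 h2 = final
    where
    module D1 = NOrder.MsLtSplit (NOrder.msLtSplit b a h1)
    module D2 = NOrder.MsLtSplit (NOrder.msLtSplit d c h2)
    p = D1.p ; U = D1.U ; y = D1.y ; A' = D1.y ∷ D1.W
    q = D2.p ; U' = D2.U ; y' = D2.y ; C' = D2.y ∷ D2.W
    K : N
    K = (p ⊗ q) ++ ((p ⊗ U') ++ ((A' ⊗ q) ++ ((p ⊗ q) ++ ((p ⊗ C') ++ (U ⊗ q)))))
    lhs = (a ⊗ d) ++ (b ⊗ c)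
    rhs = (a ⊗ c) ++ (b ⊗ d)
    lhs-split = ((p ++ A') ⊗ (q ++ U')) ++ ((p ++ U) ⊗ (q ++ C'))
    rhs-split = ((p ++ A') ⊗ (q ++ C')) ++ ((p ++ U) ⊗ (q ++ U'))
    Lc = (A' ⊗ U') ++ (U ⊗ C')
    Rc = (A' ⊗ C') ++ (U ⊗ U')
    lhs≈ : lhs ≈N lhs-split
    lhs≈ = ++-cong (⊗-cong (≈N-intro a (p ++ A') D1.eb) (≈N-intro d (q ++ U') D2.ea)) (⊗-cong (≈N-intro b (p ++ U) D1.ea) (≈N-intro c (q ++ C') D2.eb))
    rhs≈ : rhs ≈N rhs-split
    rhs≈ = ++-cong (⊗-cong (≈N-intro a (p ++ A') D1.eb) (≈N-intro c (q ++ C') D2.eb)) (⊗-cong (≈N-intro b (p ++ U) D1.ea) (≈N-intro d (q ++ U') D2.ea))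
    lhs-split≈ : lhs-split ≈N (K ++ Lc)
    lhs-split≈ = solve 6 (λ p A q U' U C → ((p :+ A) :* (q :+ U')) :+ ((p :+ U) :* (q :+ C)) :=
                    ((p :* q) :+ ((p :* U') :+ ((A :* q) :+ ((p :* q) :+ ((p :* C) :+ (U :* q)))))) :+ ((A :* U') :+ (U :* C)))
                 ≈Nrefl p A' q U' U C'
    rhs-split≈ : rhs-split ≈N (K ++ Rc)
    rhs-split≈ = solve 6 (λ p A q U' U C → ((p :+ A) :* (q :+ C)) :+ ((p :+ U) :* (q :+ U')) :=
                    ((p :* q) :+ ((p :* U') :+ ((A :* q) :+ ((p :* q) :+ ((p :* C) :+ (U :* q)))))) :+ ((A :* C) :+ (U :* U')))
                 ≈Nrefl p A' q U' U C'
    allA : All (λ e → cmpE e y ≢ gt) A'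
    allA = (λ h → eq≢gt (trans (sym (CmpE.eq-refl y)) h)) ∷ D1.allW
    allC : All (λ e → cmpE e y' ≢ gt) C'
    allC = (λ h → eq≢gt (trans (sym (CmpE.eq-refl y')) h)) ∷ D2.allW
    core : compareN Lc Rc ≡ lt
    core = NOrder.msCmp-all-lt Lc ((map (y ++_) D2.W ++ (D1.W ⊗ C')) ++ (U ⊗ U'))
      (AllP.++⁺ (All-⊗ A' U' allA D2.allU (λ {e} {f} pe qf → CmpE.≤-lt-trans {e ++ f} {y ++ f} {y ++ y'} (λ h → pe (trans (sym (cmpE-++ʳ f e y)) h)) (trans (cmpE-++ˡ y f y') qf)))
                (All-⊗ U C' D1.allU allC (λ {e} {f} pe qf → CmpE.lt-≤-trans {e ++ f} {y ++ f} {y ++ y'} (trans (cmpE-++ʳ f e y) pe) (λ h → qf (trans (sym (cmpE-++ˡ y f y')) h)))))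
    final : compareN lhs rhs ≡ lt
    final = CmpN.eq-transˡ {lhs} {K ++ Lc} {rhs} (un≈N (≈Ntrans lhs≈ lhs-split≈))
              (CmpN.eq-transʳ {K ++ Lc} {K ++ Rc} {rhs} (un≈N (≈Nsym (≈Ntrans rhs≈ rhs-split≈))) (trans (NOrder.msCmp-++ˡ K Lc Rc) core))

module Integers (α : Ordinal) where
  open import Level using (0ℓ)
  open Comparison
  open Naturals α
  open import Data.List using (List; []; _++_)
  import Data.List.Properties as LP
  open import Data.Product using (_,_; proj₁; proj₂)
  open import Data.Sum using (_⊎_; inj₁; inj₂)
  open import Data.Empty using (⊥; ⊥-elim)
  open import Data.Bool using (T; not)
  open import Data.Unit using (tt)
  open import Relation.Nullary using (¬_; Dec; yes; no)
  open import Relation.Binary.PropositionalEquality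
  open import Algebra.Structures
  open import Algebra.Bundles
  open import Algebra.Solver.Ring.AlmostCommutativeRing using (fromCommutativeRing)
  import Algebra.Solver.Ring.Simple as Simple

  open Arith α
  open import Relation.Binary.Reasoning.Setoid (CommutativeSemiring.setoid ++-⊗-commutativeSemiring)

  infix 4 _≈Z_
  record _≈Z_ (x y : Z) : Set where
    constructor ≈Z⟨_⟩
    field un≈Z : (proj₁ x ++ proj₂ y) ≈N (proj₂ x ++ proj₁ y)
  open _≈Z_ public

  ++-cancelʳ : ∀ u a b → (a ++ u) ≈N (b ++ u) → a ≈N b
  ++-cancelʳ u a b ≈N⟨ h ⟩ = ≈N⟨ trans (sym (NOrder.msCmp-++ʳ u a b)) h ⟩

  ++-comm-≈N : ∀ a b → (a ++ b) ≈N (b ++ a)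
  ++-comm-≈N a b = ≈N⟨ NOrder.msCmp-++-comm a b ⟩

  ≈Zrefl : ∀ {x} → x ≈Z x
  ≈Zrefl {a , b} = ≈Z⟨ ++-comm-≈N a b ⟩

  ≈Zsym : ∀ {x y} → x ≈Z y → y ≈Z x
  ≈Zsym {a , b} {c , d} ≈Z⟨ h ⟩ = ≈Z⟨ ≈Ntrans (++-comm-≈N c b) (≈Ntrans (≈Nsym h) (++-comm-≈N a d)) ⟩

  ≈Ztrans : ∀ {x y z} → x ≈Z y → y ≈Z z → x ≈Z z
  ≈Ztrans {a , b} {c , d} {e , f} ≈Z⟨ h ⟩ ≈Z⟨ k ⟩ = ≈Z⟨ ++-cancelʳ (c ++ d) (a ++ f) (b ++ e) chain ⟩
    where
    chain : ((a ++ f) ++ (c ++ d)) ≈N ((b ++ e) ++ (c ++ d))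
    chain = begin
            ((a ++ f) ++ (c ++ d))
              ≈⟨ solve 4 (λ a f c d → ((a :+ f) :+ (c :+ d)) := ((a :+ d) :+ (c :+ f))) ≈Nrefl a f c d ⟩
            ((a ++ d) ++ (c ++ f)) ≈⟨ ++-cong h k ⟩
            ((b ++ c) ++ (d ++ e))
              ≈⟨ solve 4 (λ b c d e → ((b :+ c) :+ (d :+ e)) := ((b :+ e) :+ (c :+ d))) ≈Nrefl b c d e ⟩
            ((b ++ e) ++ (c ++ d)) ∎

  open NSolver using (con)

  +Z-cong : ∀ {x x' y y'} → x ≈Z x' → y ≈Z y' → addZ x y ≈Z addZ x' y'
  +Z-cong {a , b} {a' , b'} {c , d} {c' , d'} ≈Z⟨ h ⟩ ≈Z⟨ k ⟩ = ≈Z⟨ begin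
    ((a ++ c) ++ (b' ++ d')) ≈⟨ solve 4 (λ a c b' d' → ((a :+ c) :+ (b' :+ d')) := ((a :+ b') :+ (c :+ d'))) ≈Nrefl a c b' d' ⟩
    ((a ++ b') ++ (c ++ d')) ≈⟨ ++-cong h k ⟩
    ((b ++ a') ++ (d ++ c')) ≈⟨ solve 4 (λ b a' d c' → ((b :+ a') :+ (d :+ c')) := ((b :+ d) :+ (a' :+ c'))) ≈Nrefl b a' d c' ⟩
    ((b ++ d) ++ (a' ++ c')) ∎ ⟩

  -Z-cong : ∀ {x x'} → x ≈Z x' → negZ x ≈Z negZ x'
  -Z-cong {a , b} {a' , b'} ≈Z⟨ h ⟩ = ≈Z⟨ ≈Nsym h ⟩

  *Z-congL : ∀ {x x'} y → x ≈Z x' → mulZ x y ≈Z mulZ x' y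
  *Z-congL {a , b} {a' , b'} (c , d) ≈Z⟨ h ⟩ = ≈Z⟨ begin
    (((a ⊗ c) ++ (b ⊗ d)) ++ ((a' ⊗ d) ++ (b' ⊗ c)))
       ≈⟨ solve 6 (λ a b a' b' c d → (((a :* c) :+ (b :* d)) :+ ((a' :* d) :+ (b' :* c))) := (((a :+ b') :* c) :+ ((b :+ a') :* d))) ≈Nrefl a b a' b' c d ⟩
    (((a ++ b') ⊗ c) ++ ((b ++ a') ⊗ d)) ≈⟨ ++-cong (⊗-cong h (≈Nrefl {c})) (⊗-cong (≈Nsym h) (≈Nrefl {d})) ⟩
    (((b ++ a') ⊗ c) ++ ((a ++ b') ⊗ d))
       ≈⟨ solve 6 (λ a b a' b' c d → (((b :+ a') :* c) :+ ((a :+ b') :* d)) := (((a :* d) :+ (b :* c)) :+ ((a' :* c) :+ (b' :* d)))) ≈Nrefl a b a' b' c d ⟩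
    (((a ⊗ d) ++ (b ⊗ c)) ++ ((a' ⊗ c) ++ (b' ⊗ d))) ∎ ⟩

  *Z-congR : ∀ x {y y'} → y ≈Z y' → mulZ x y ≈Z mulZ x y'
  *Z-congR (a' , b') {c , d} {c' , d'} ≈Z⟨ k ⟩ = ≈Z⟨ begin
    (((a' ⊗ c) ++ (b' ⊗ d)) ++ ((a' ⊗ d') ++ (b' ⊗ c')))
       ≈⟨ solve 6 (λ a' b' c d c' d' → (((a' :* c) :+ (b' :* d)) :+ ((a' :* d') :+ (b' :* c'))) := ((a' :* (c :+ d')) :+ (b' :* (d :+ c')))) ≈Nrefl a' b' c d c' d' ⟩
    ((a' ⊗ (c ++ d')) ++ (b' ⊗ (d ++ c'))) ≈⟨ ++-cong (⊗-cong (≈Nrefl {a'}) k) (⊗-cong (≈Nrefl {b'}) (≈Nsym k)) ⟩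
    ((a' ⊗ (d ++ c')) ++ (b' ⊗ (c ++ d')))
       ≈⟨ solve 6 (λ a' b' c d c' d' → ((a' :* (d :+ c')) :+ (b' :* (c :+ d'))) := (((a' :* d) :+ (b' :* c)) :+ ((a' :* c') :+ (b' :* d')))) ≈Nrefl a' b' c d c' d' ⟩
    (((a' ⊗ d) ++ (b' ⊗ c)) ++ ((a' ⊗ c') ++ (b' ⊗ d'))) ∎ ⟩

  *Z-cong : ∀ {x x' y y'} → x ≈Z x' → y ≈Z y' → mulZ x y ≈Z mulZ x' y'
  *Z-cong {x} {x'} {y} {y'} h k = ≈Ztrans (*Z-congL y h) (*Z-congR x' k)

  isCommutativeRing-Z : IsCommutativeRing _≈Z_ addZ mulZ negZ zeroZ oneZ
  isCommutativeRing-Z = record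
    { isRing = record
      { +-isAbelianGroup = record
        { isGroup = record
          { isMonoid = record
            { isSemigroup = record
              { isMagma = record
                { isEquivalence = record { refl = ≈Zrefl ; sym = ≈Zsym ; trans = ≈Ztrans }
                ; ∙-cong = +Z-cong }
              ; assoc = λ { (a , b) (c , d) (e , f) → ≈Z⟨ solve 6 (λ a b c d e f → (((a :+ c) :+ e) :+ (b :+ (d :+ f))) := (((b :+ d) :+ f) :+ (a :+ (c :+ e)))) ≈Nrefl a b c d e f ⟩ } }
            ; identity = (λ { (a , b) → ≈Z⟨ ++-comm-≈N a b ⟩ }) , (λ { (a , b) → ≈Z⟨ solve 2 (λ a b → ((a :+ con 0) :+ b) := ((b :+ con 0) :+ a)) ≈Nrefl a b ⟩ }) }
          ; inverse = (λ { (a , b) → ≈Z⟨ solve 2 (λ a b → ((b :+ a) :+ con 0) := ((a :+ b) :+ con 0)) ≈Nrefl a b ⟩ })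
                    , (λ { (a , b) → ≈Z⟨ solve 2 (λ a b → ((a :+ b) :+ con 0) := ((b :+ a) :+ con 0)) ≈Nrefl a b ⟩ })
          ; ⁻¹-cong = -Z-cong }
        ; comm = λ { (a , b) (c , d) → ≈Z⟨ solve 4 (λ a b c d → ((a :+ c) :+ (d :+ b)) := ((b :+ d) :+ (c :+ a))) ≈Nrefl a b c d ⟩ } }
      ; *-cong = *Z-cong
      ; *-assoc = λ { (a , b) (c , d) (e , f) → ≈Z⟨ solve 6 (λ a b c d e f →
            (((((a :* c) :+ (b :* d)) :* e) :+ (((a :* d) :+ (b :* c)) :* f)) :+ ((a :* ((c :* f) :+ (d :* e))) :+ (b :* ((c :* e) :+ (d :* f)))))
            := (((((a :* c) :+ (b :* d)) :* f) :+ (((a :* d) :+ (b :* c)) :* e)) :+ ((a :* ((c :* e) :+ (d :* f))) :+ (b :* ((c :* f) :+ (d :* e))))))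
            ≈Nrefl a b c d e f ⟩ }
      ; *-identity = (λ { (a , b) → ≈Z⟨ solve 2 (λ a b → (((con 1 :* a) :+ (con 0 :* b)) :+ b) := (((con 1 :* b) :+ (con 0 :* a)) :+ a)) ≈Nrefl a b ⟩ })
                   , (λ { (a , b) → ≈Z⟨ solve 2 (λ a b → (((a :* con 1) :+ (b :* con 0)) :+ b) := (((a :* con 0) :+ (b :* con 1)) :+ a)) ≈Nrefl a b ⟩ })
      ; distrib = (λ { (a , b) (c , d) (e , f) → ≈Z⟨ solve 6 (λ a b c d e f →
            (((a :* (c :+ e)) :+ (b :* (d :+ f))) :+ (((a :* d) :+ (b :* c)) :+ ((a :* f) :+ (b :* e))))
            := (((a :* (d :+ f)) :+ (b :* (c :+ e))) :+ (((a :* c) :+ (b :* d)) :+ ((a :* e) :+ (b :* f))))) ≈Nrefl a b c d e f ⟩ })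
                , (λ { (a , b) (c , d) (e , f) → ≈Z⟨ solve 6 (λ a b c d e f →
            ((((c :+ e) :* a) :+ ((d :+ f) :* b)) :+ (((c :* b) :+ (d :* a)) :+ ((e :* b) :+ (f :* a))))
            := ((((c :+ e) :* b) :+ ((d :+ f) :* a)) :+ (((c :* a) :+ (d :* b)) :+ ((e :* a) :+ (f :* b))))) ≈Nrefl a b c d e f ⟩ }) }
    ; *-comm = λ { (a , b) (c , d) → ≈Z⟨ solve 4 (λ a b c d → (((a :* c) :+ (b :* d)) :+ ((c :* b) :+ (d :* a))) := (((a :* d) :+ (b :* c)) :+ ((c :* a) :+ (d :* b)))) ≈Nrefl a b c d ⟩ } }

  commutativeRing-Z : CommutativeRing 0ℓ 0ℓ
  commutativeRing-Z = record { isCommutativeRing = isCommutativeRing-Z }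

  T-isEQ⇒eq : ∀ {r} → T (isEQ r) → r ≡ eq
  T-isEQ⇒eq {eq} _ = refl
  eq⇒T-isEQ : ∀ {r} → r ≡ eq → T (isEQ r)
  eq⇒T-isEQ refl = tt

  _≟Z_ : ∀ x y → Dec (x ≈Z y)
  (a , b) ≟Z (c , d) with compareN (a ++ d) (b ++ c) in h
  ... | eq = yes ≈Z⟨ ≈N⟨ h ⟩ ⟩
  ... | lt = no λ { ≈Z⟨ ≈N⟨ k ⟩ ⟩ → lt≢eq (trans (sym h) k) }
  ... | gt = no λ { ≈Z⟨ ≈N⟨ k ⟩ ⟩ → gt≢eq (trans (sym h) k) }

  eqZ⇒≈Z : ∀ x y → T (eqZ x y) → x ≈Z y
  eqZ⇒≈Z (a , b) (c , d) t = ≈Z⟨ ≈N⟨ trans (sym (cmpN≡compareN (a ++ d) (b ++ c))) (T-isEQ⇒eq t) ⟩ ⟩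
  ≈Z⇒eqZ : ∀ x y → x ≈Z y → T (eqZ x y)
  ≈Z⇒eqZ (a , b) (c , d) ≈Z⟨ ≈N⟨ h ⟩ ⟩ = eq⇒T-isEQ (trans (cmpN≡compareN (a ++ d) (b ++ c)) h)

  NonNegZ : Z → Set
  NonNegZ x = compareN (proj₂ x) (proj₁ x) ≢ gt

  T-not-isGT⇒≢gt : ∀ {r} → T (not (isGT r)) → r ≢ gt
  T-not-isGT⇒≢gt {lt} _ ()
  T-not-isGT⇒≢gt {eq} _ ()
  T-not-isGT⇒≢gt {gt} () _
  ≢gt⇒T-not-isGT : ∀ {r} → r ≢ gt → T (not (isGT r))
  ≢gt⇒T-not-isGT {lt} _ = tt
  ≢gt⇒T-not-isGT {eq} _ = tt
  ≢gt⇒T-not-isGT {gt} n = n refl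

  geZ⇒NonNegZ : ∀ x → T (geZ x zeroZ) → NonNegZ x
  geZ⇒NonNegZ (a , b) t = subst₂ (λ u v → compareN u v ≢ gt) (LP.++-identityʳ b) (LP.++-identityʳ a)
                     (λ h → T-not-isGT⇒≢gt t (trans (cmpN≡compareN (b ++ []) (a ++ [])) h))
  NonNegZ⇒geZ : ∀ x → NonNegZ x → T (geZ x zeroZ)
  NonNegZ⇒geZ (a , b) n = ≢gt⇒T-not-isGT (λ h → n (subst₂ (λ u v → compareN u v ≡ gt) (LP.++-identityʳ b) (LP.++-identityʳ a) (trans (sym (cmpN≡compareN (b ++ []) (a ++ []))) h)))

  compareN-cong : ∀ {a a' b b' r} → a ≈N a' → b ≈N b' → compareN a b ≡ r → compareN a' b' ≡ r
  compareN-cong {a} {a'} {b} {b'} ≈N⟨ h ⟩ ≈N⟨ k ⟩ e = trans (sym (CmpN.eq-cong₂ {a} {a'} {b} {b'} h k)) e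

  NonNegZ-resp : ∀ {x y} → x ≈Z y → NonNegZ x → NonNegZ y
  NonNegZ-resp {a , b} {c , d} ≈Z⟨ h ⟩ n e = n (trans (sym (NOrder.msCmp-++ʳ d b a)) s)
    where
    s : compareN (b ++ d) (a ++ d) ≡ gt
    s = CmpN.eq-transʳ {b ++ d} {b ++ c} {a ++ d} (un≈N (≈Nsym h))
          (trans (NOrder.msCmp-++ˡ b d c) e)

  NonNegZ-+ : ∀ {x y} → NonNegZ x → NonNegZ y → NonNegZ (addZ x y)
  NonNegZ-+ {a , b} {c , d} n1 n2 = CmpN.≤-≤-trans {b ++ d} {a ++ d} {a ++ c}
     (λ h → n1 (trans (sym (NOrder.msCmp-++ʳ d b a)) h)) (λ h → n2 (trans (sym (NOrder.msCmp-++ˡ a d c)) h))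

  NonNegZ-total : ∀ x → NonNegZ x ⊎ NonNegZ (negZ x)
  NonNegZ-total (a , b) with compareN b a in h
  ... | lt = inj₁ (λ ())
  ... | eq = inj₁ (λ ())
  ... | gt = inj₂ (λ k → lt≢gt (trans (sym (CmpN.gt⇒swap-lt {b} {a} h)) k))

  NonNegZ-antisym : ∀ {x} → NonNegZ x → NonNegZ (negZ x) → x ≈Z zeroZ
  NonNegZ-antisym {a , b} n1 n2 with compareN a b in h
  ... | eq = ≈Z⟨ ≈N⟨ subst₂ (λ u v → compareN u v ≡ eq) (sym (LP.++-identityʳ a)) (sym (LP.++-identityʳ b)) h ⟩ ⟩
  ... | lt = ⊥-elim (n1 (CmpN.lt⇒swap-gt {a} {b} h))
  ... | gt = ⊥-elim (n2 refl)

  NonNegZ-* : ∀ {x y} → NonNegZ x → NonNegZ y → NonNegZ (mulZ x y)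
  NonNegZ-* {a , b} {c , d} n1 n2 with compareN b a in h1 | compareN d c in h2
  ... | gt | _ = ⊥-elim (n1 refl)
  ... | _ | gt = ⊥-elim (n2 refl)
  ... | lt | lt = λ k → lt≢gt (trans (sym (cross-< a b c d h1 h2)) k)
  ... | eq | _ = λ k → eq≢gt (trans (sym (un≈N e)) k)
    where
    e : (((a ⊗ d) ++ (b ⊗ c))) ≈N ((a ⊗ c) ++ (b ⊗ d))
    e = begin ((a ⊗ d) ++ (b ⊗ c)) ≈⟨ ++-cong (⊗-cong (≈Nsym (≈N-intro b a h1)) (≈Nrefl {d})) (⊗-cong (≈N-intro b a h1) (≈Nrefl {c})) ⟩
        ((b ⊗ d) ++ (a ⊗ c)) ≈⟨ ++-comm-≈N (b ⊗ d) (a ⊗ c) ⟩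
        ((a ⊗ c) ++ (b ⊗ d)) ∎
  ... | lt | eq = λ k → eq≢gt (trans (sym (un≈N e)) k)
    where
    e : (((a ⊗ d) ++ (b ⊗ c))) ≈N ((a ⊗ c) ++ (b ⊗ d))
    e = begin ((a ⊗ d) ++ (b ⊗ c)) ≈⟨ ++-cong (⊗-cong (≈Nrefl {a}) (≈N-intro d c h2)) (⊗-cong (≈Nrefl {b}) (≈Nsym (≈N-intro d c h2))) ⟩
        ((a ⊗ c) ++ (b ⊗ d)) ∎

  ≉0-split : ∀ {a b} → ¬ (a , b) ≈Z zeroZ → (compareN b a ≡ lt) ⊎ (compareN a b ≡ lt)
  ≉0-split {a} {b} n with compareN b a in h
  ... | lt = inj₁ refl
  ... | gt = inj₂ (CmpN.gt⇒swap-lt {b} {a} h)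
  ... | eq = ⊥-elim (n ≈Z⟨ ≈N⟨ subst₂ (λ u v → compareN u v ≡ eq) (sym (LP.++-identityʳ a)) (sym (LP.++-identityʳ b)) (CmpN.eq-sym {b} {a} h) ⟩ ⟩)

  *Z-≉0 : ∀ {x y} → ¬ x ≈Z zeroZ → ¬ y ≈Z zeroZ → ¬ mulZ x y ≈Z zeroZ
  *Z-≉0 {a , b} {c , d} nx ny ≈Z⟨ ≈N⟨ hz ⟩ ⟩ = go (≉0-split nx) (≉0-split ny)
    where
    X = (a ⊗ c) ++ (b ⊗ d)
    Y = (a ⊗ d) ++ (b ⊗ c)
    XY : compareN X Y ≡ eq
    XY = subst₂ (λ u v → compareN u v ≡ eq) (LP.++-identityʳ X) (LP.++-identityʳ Y) hz
    YX : compareN Y X ≡ eq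
    YX = CmpN.eq-sym {X} {Y} XY
    go : (compareN b a ≡ lt) ⊎ (compareN a b ≡ lt) → (compareN d c ≡ lt) ⊎ (compareN c d ≡ lt) → ⊥
    go (inj₁ h1) (inj₁ h2) = lt≢eq (trans (sym (cross-< a b c d h1 h2)) YX)
    go (inj₁ h1) (inj₂ h2) = lt≢eq (trans (sym (cross-< a b d c h1 h2)) XY)
    go (inj₂ h1) (inj₁ h2) = lt≢eq (trans (sym (compareN-cong (++-comm-≈N (b ⊗ d) (a ⊗ c)) (++-comm-≈N (b ⊗ c) (a ⊗ d)) (cross-< b a c d h1 h2))) XY)
    go (inj₂ h1) (inj₂ h2) = lt≢eq (trans (sym (compareN-cong (++-comm-≈N (b ⊗ c) (a ⊗ d)) (++-comm-≈N (b ⊗ d) (a ⊗ c)) (cross-< b a d c h1 h2))) YX)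

  1≉0 : ¬ oneZ ≈Z zeroZ
  1≉0 ≈Z⟨ ≈N⟨ h ⟩ ⟩ = gt≢eq h

  module ZSolver = Simple (fromCommutativeRing commutativeRing-Z) _≟Z_

module Rationals (α : Ordinal) where
  open Comparison
  open Naturals α using (≈N⟨_⟩; ≈Nrefl; module NSolver) renaming (solve to nsolve)
  open Integers α
  open import Data.Product using (_×_; _,_; proj₁; proj₂)
  open import Data.Sum using (_⊎_; inj₁; inj₂)
  open import Data.Empty using (⊥; ⊥-elim)
  open import Data.Bool using (true; false; T; not)
  open import Data.Bool.Properties using (T-∧)
  open import Function.Bundles using (Equivalence)
  open import Data.Unit using (tt)
  open import Data.Nat using (ℕ)
  open import Relation.Nullary using (¬_; Dec; yes; no)
  open import Relation.Binary.PropositionalEquality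
  open import Algebra.Bundles

  open Arith α
  module ZR = CommutativeRing commutativeRing-Z
  open ZSolver using (Polynomial; :-_; con) renaming (_:+_ to _⊞_; _:*_ to _⊠_; _:=_ to _≐_; solve to zsolve)

  -- Identities of ℚ_α are proved on representatives: FracPoly mirrors addR and subR on polynomial
  -- numerators and denominators and _≐q_ is cross-multiplication, so they become ring identities of ℤ_α.
  FracPoly : ℕ → Set
  FracPoly n = Polynomial n × Polynomial n

  addP subP : ∀ {n} → FracPoly n → FracPoly n → FracPoly n
  addP (a , b) (c , d) = ((a ⊠ d) ⊞ (b ⊠ c) , b ⊠ d)
  subP (a , b) (c , d) = ((a ⊠ d) ⊞ (:- (b ⊠ c)) , b ⊠ d)
  negP halfP : ∀ {n} → FracPoly n → FracPoly n
  negP (a , b) = (:- a , b)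
  halfP (a , b) = (a , b ⊞ b)
  zeroP : ∀ {n} → FracPoly n
  zeroP = (con zeroZ , con oneZ)

  _≐q_ : ∀ {n} → FracPoly n → FracPoly n → _
  x ≐q y = (proj₁ x ⊠ proj₂ y) ≐ (proj₂ x ⊠ proj₁ y)

  -- For identities involving halfq the normal forms of the ℤ_α solver agree only up to ≈Z, not
  -- definitionally, so these are checked one level further down, over ℕ_α.
  open NSolver using () renaming (Polynomial to NPoly; _:+_ to _⊞ₙ_; _:*_ to _⊠ₙ_; _:=_ to _≐ₙ_)

  IntPoly : ℕ → Set
  IntPoly n = NPoly n × NPoly n

  addIP mulIP : ∀ {n} → IntPoly n → IntPoly n → IntPoly n
  addIP (a , b) (c , d) = (a ⊞ₙ c , b ⊞ₙ d)
  mulIP (a , b) (c , d) = ((a ⊠ₙ c) ⊞ₙ (b ⊠ₙ d) , (a ⊠ₙ d) ⊞ₙ (b ⊠ₙ c))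

  negIP : ∀ {n} → IntPoly n → IntPoly n
  negIP (a , b) = (b , a)

  RatPoly : ℕ → Set
  RatPoly n = IntPoly n × IntPoly n

  addRP subRP : ∀ {n} → RatPoly n → RatPoly n → RatPoly n
  addRP (a , b) (c , d) = (addIP (mulIP a d) (mulIP b c) , mulIP b d)
  subRP (a , b) (c , d) = (addIP (mulIP a d) (negIP (mulIP b c)) , mulIP b d)

  halfRP : ∀ {n} → RatPoly n → RatPoly n
  halfRP (a , b) = (a , addIP b b)

  _≐RP_ : ∀ {n} → RatPoly n → RatPoly n → _
  (n₁ , d₁) ≐RP (n₂ , d₂) = (proj₁ (mulIP n₁ d₂) ⊞ₙ proj₂ (mulIP d₁ n₂)) ≐ₙ (proj₂ (mulIP n₁ d₂) ⊞ₙ proj₁ (mulIP d₁ n₂))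

  record _≈r_ (x y : QR) : Set where
    constructor ≈r⟨_⟩
    field un≈r : mulZ (proj₁ x) (proj₂ y) ≈Z mulZ (proj₂ x) (proj₁ y)
  open _≈r_ public

  NonNegZ-0 : NonNegZ zeroZ
  NonNegZ-0 ()

  *Z-cancelˡ : ∀ {d p q} → ¬ d ≈Z zeroZ → mulZ d p ≈Z mulZ d q → p ≈Z q
  *Z-cancelˡ {d} {p} {q} nd h with addZ p (negZ q) ≟Z zeroZ
  ... | yes w0 = ≈Ztrans (zsolve 2 (λ p q → p ≐ ((p ⊞ (:- q)) ⊞ q)) ≈Zrefl p q)
                   (≈Ztrans (+Z-cong w0 (≈Zrefl {q})) (zsolve 1 (λ q → (con zeroZ ⊞ q) ≐ q) ≈Zrefl q))
  ... | no w≠0 = ⊥-elim (*Z-≉0 nd w≠0 dw0)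
    where
    dw0 : mulZ d (addZ p (negZ q)) ≈Z zeroZ
    dw0 = ≈Ztrans (zsolve 3 (λ d p q → (d ⊠ (p ⊞ (:- q))) ≐ ((d ⊠ p) ⊞ (:- (d ⊠ q)))) ≈Zrefl d p q)
            (≈Ztrans (+Z-cong h (≈Zrefl {negZ (mulZ d q)})) (zsolve 1 (λ x → (x ⊞ (:- x)) ≐ con zeroZ) ≈Zrefl (mulZ d q)))

  NonNegZ-square : ∀ z → NonNegZ (mulZ z z)
  NonNegZ-square z with NonNegZ-total z
  ... | inj₁ n = NonNegZ-* {z} {z} n n
  ... | inj₂ n = NonNegZ-resp (zsolve 1 (λ z → ((:- z) ⊠ (:- z)) ≐ (z ⊠ z)) ≈Zrefl z) (NonNegZ-* {negZ z} {negZ z} n n)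

  NonNegZ-cancelʳ : ∀ {z p} → NonNegZ (mulZ z p) → NonNegZ p → ¬ p ≈Z zeroZ → NonNegZ z
  NonNegZ-cancelʳ {z} {p} h np nzp with NonNegZ-total z
  ... | inj₁ n = n
  ... | inj₂ n with z ≟Z zeroZ
  ...   | yes z0 = NonNegZ-resp (≈Zsym z0) NonNegZ-0
  ...   | no nz = ⊥-elim (*Z-≉0 nz nzp zp0)
    where
    zp0 : mulZ z p ≈Z zeroZ
    zp0 = NonNegZ-antisym {mulZ z p} h (NonNegZ-resp (zsolve 2 (λ z p → ((:- z) ⊠ p) ≐ (:- (z ⊠ p))) ≈Zrefl z p) (NonNegZ-* {negZ z} {p} n np))

  NonNegR : QR → Set
  NonNegR x = NonNegZ (mulZ (proj₁ x) (proj₂ x))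

  NonZeroDen : QR → Set
  NonZeroDen x = ¬ (proj₂ x ≈Z zeroZ)

  ≈r-refl : ∀ {x} → x ≈r x
  ≈r-refl {n , d} = ≈r⟨ ZR.*-comm n d ⟩

  ≈r-sym : ∀ {x y} → x ≈r y → y ≈r x
  ≈r-sym {n , d} {n' , d'} ≈r⟨ h ⟩ = ≈r⟨ ≈Ztrans (ZR.*-comm n' d) (≈Ztrans (≈Zsym h) (ZR.*-comm n d')) ⟩

  ≈r-trans : ∀ {x y z} → NonZeroDen y → x ≈r y → y ≈r z → x ≈r z
  ≈r-trans {n1 , d1} {n2 , d2} {n3 , d3} nz ≈r⟨ h ⟩ ≈r⟨ k ⟩ = ≈r⟨ *Z-cancelˡ nz chain ⟩
    where
    chain : mulZ d2 (mulZ n1 d3) ≈Z mulZ d2 (mulZ d1 n3)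
    chain = ≈Ztrans (zsolve 3 (λ d2 n1 d3 → (d2 ⊠ (n1 ⊠ d3)) ≐ ((n1 ⊠ d2) ⊠ d3)) ≈Zrefl d2 n1 d3)
           (≈Ztrans (*Z-cong h (≈Zrefl {d3}))
           (≈Ztrans (zsolve 3 (λ d1 n2 d3 → ((d1 ⊠ n2) ⊠ d3) ≐ (d1 ⊠ (n2 ⊠ d3))) ≈Zrefl d1 n2 d3)
           (≈Ztrans (*Z-cong (≈Zrefl {d1}) k)
               (zsolve 3 (λ d1 d2 n3 → (d1 ⊠ (d2 ⊠ n3)) ≐ (d2 ⊠ (d1 ⊠ n3))) ≈Zrefl d1 d2 n3))))

  NonNegR-resp : ∀ {x y} → NonZeroDen x → x ≈r y → NonNegR x → NonNegR y
  NonNegR-resp {n , d} {n' , d'} nzx ≈r⟨ h ⟩ nx = NonNegZ-cancelʳ {mulZ n' d'} {mulZ d d} (NonNegZ-resp (≈Zsym e) (NonNegZ-* {mulZ n d} {mulZ d' d'} nx (NonNegZ-square d'))) (NonNegZ-square d) (*Z-≉0 nzx nzx)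
    where
    e : mulZ (mulZ n' d') (mulZ d d) ≈Z mulZ (mulZ n d) (mulZ d' d')
    e = ≈Ztrans (zsolve 4 (λ n' d' d n → ((n' ⊠ d') ⊠ (d ⊠ d)) ≐ ((d ⊠ n') ⊠ (d' ⊠ d))) ≈Zrefl n' d' d n)
         (≈Ztrans (*Z-cong (≈Zsym h) (≈Zrefl {mulZ d' d}))
             (zsolve 4 (λ n' d' d n → ((n ⊠ d') ⊠ (d' ⊠ d)) ≐ ((n ⊠ d) ⊠ (d' ⊠ d'))) ≈Zrefl n' d' d n))

  NonNegR-+ : ∀ {x y} → NonNegR x → NonNegR y → NonNegR (addR x y)
  NonNegR-+ {n , d} {n' , d'} hx hy = NonNegZ-resp (≈Zsym e) (NonNegZ-+ {mulZ (mulZ n d) (mulZ d' d')} {mulZ (mulZ n' d') (mulZ d d)} (NonNegZ-* {mulZ n d} {mulZ d' d'} hx (NonNegZ-square d')) (NonNegZ-* {mulZ n' d'} {mulZ d d} hy (NonNegZ-square d)))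
    where
    e : mulZ (addZ (mulZ n d') (mulZ d n')) (mulZ d d') ≈Z addZ (mulZ (mulZ n d) (mulZ d' d')) (mulZ (mulZ n' d') (mulZ d d))
    e = zsolve 4 (λ n d n' d' → (((n ⊠ d') ⊞ (d ⊠ n')) ⊠ (d ⊠ d')) ≐ (((n ⊠ d) ⊠ (d' ⊠ d')) ⊞ ((n' ⊠ d') ⊠ (d ⊠ d)))) ≈Zrefl n d n' d'

  NonNegR-total : ∀ x → NonNegR x ⊎ NonNegR (negR x)
  NonNegR-total (n , d) with NonNegZ-total (mulZ n d)
  ... | inj₁ h = inj₁ h
  ... | inj₂ h = inj₂ (NonNegZ-resp (zsolve 2 (λ n d → (:- (n ⊠ d)) ≐ ((:- n) ⊠ d)) ≈Zrefl n d) h)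

  NonNegR-antisym : ∀ {x} → NonZeroDen x → NonNegR x → NonNegR (negR x) → x ≈r zeroR
  NonNegR-antisym {n , d} nz h1 h2 = ≈r⟨ ≈Ztrans (zsolve 1 (λ n → (n ⊠ con oneZ) ≐ n) ≈Zrefl n) (≈Ztrans n0 (zsolve 1 (λ d → con zeroZ ≐ (d ⊠ con zeroZ)) ≈Zrefl d)) ⟩
    where
    nd0 : mulZ n d ≈Z zeroZ
    nd0 = NonNegZ-antisym {mulZ n d} h1 (NonNegZ-resp (zsolve 2 (λ n d → ((:- n) ⊠ d) ≐ (:- (n ⊠ d))) ≈Zrefl n d) h2)
    n0 : n ≈Z zeroZ
    n0 with n ≟Z zeroZ
    ... | yes e = e
    ... | no ne = ⊥-elim (*Z-≉0 ne nz nd0)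

  NonNegR-0 : NonNegR zeroR
  NonNegR-0 = NonNegZ-resp (zsolve 0 (con zeroZ ≐ (con zeroZ ⊠ con oneZ)) ≈Zrefl) NonNegZ-0

  T-not⇒¬T : ∀ {a} → T (not a) → ¬ T a
  T-not⇒¬T {false} _ ()

  ¬T⇒≡false : ∀ {a} → ¬ T a → a ≡ false
  ¬T⇒≡false {false} _ = refl
  ¬T⇒≡false {true} n = ⊥-elim (n tt)

  ¬T⇒T-not : ∀ {a} → ¬ T a → T (not a)
  ¬T⇒T-not n = subst (λ a → T (not a)) (sym (¬T⇒≡false n)) tt

  den≉0 : (q : Q) → NonZeroDen (raw q)
  den≉0 (frac n d p) h = subst T p (≈Z⇒eqZ d zeroZ h)

  mkQ : (p : QR) → NonZeroDen p → Q
  mkQ (n , d) nz = frac n d (¬T⇒≡false (λ t → nz (eqZ⇒≈Z d zeroZ t)))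

  infixl 6 _+q_ _-q_
  _+q_ _-q_ : Q → Q → Q
  x +q y = mkQ (addR (raw x) (raw y)) (*Z-≉0 (den≉0 x) (den≉0 y))
  x -q y = mkQ (subR (raw x) (raw y)) (*Z-≉0 (den≉0 x) (den≉0 y))
  negq : Q → Q
  negq x = mkQ (negR (raw x)) (den≉0 x)

  halfR : QR → QR
  halfR (n , d) = (n , addZ d d)

  twoZ : Z
  twoZ = addZ oneZ oneZ
  two≉0 : ¬ twoZ ≈Z zeroZ
  two≉0 ≈Z⟨ ≈N⟨ () ⟩ ⟩

  halfq : Q → Q
  halfq x = mkQ (halfR (raw x)) λ h → *Z-≉0 (den≉0 x) two≉0 (≈Ztrans (zsolve 1 (λ d → (d ⊠ (con oneZ ⊞ con oneZ)) ≐ (d ⊞ d)) ≈Zrefl (Q.den x)) h)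

  0q : Q
  0q = mkQ zeroR 1≉0

  infix 4 _≃_ _≤q_ _<q_
  record _≃_ (x y : Q) : Set where
    constructor ≃⟨_⟩
    field un≃ : raw x ≈r raw y
  open _≃_ public
  NonNegQ : Q → Set
  NonNegQ x = NonNegR (raw x)
  PosQ : Q → Set
  PosQ x = NonNegQ x × ¬ (x ≃ 0q)
  record _≤q_ (x y : Q) : Set where
    constructor ≤⟨_⟩
    field un≤ : NonNegQ (y -q x)
  open _≤q_ public
  record _<q_ (x y : Q) : Set where
    constructor <⟨_⟩
    field un< : PosQ (y -q x)
  open _<q_ public

  ≃-refl : ∀ {x} → x ≃ x
  ≃-refl = ≃⟨ ≈r-refl ⟩
  ≃-sym : ∀ {x y} → x ≃ y → y ≃ x
  ≃-sym ≃⟨ h ⟩ = ≃⟨ ≈r-sym h ⟩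
  ≃-trans : ∀ {x y z} → x ≃ y → y ≃ z → x ≃ z
  ≃-trans {x} {y} {z} ≃⟨ h ⟩ ≃⟨ k ⟩ = ≃⟨ ≈r-trans {raw x} {raw y} {raw z} (den≉0 y) h k ⟩

  NonNegQ-resp : ∀ {x y} → x ≃ y → NonNegQ x → NonNegQ y
  NonNegQ-resp {x} {y} ≃⟨ h ⟩ = NonNegR-resp {raw x} {raw y} (den≉0 x) h

  PosQ-resp : ∀ {x y} → x ≃ y → PosQ x → PosQ y
  PosQ-resp {x} {y} e (n , nz) = NonNegQ-resp e n , λ h → nz (≃-trans e h)

  ≈⇒≃ : ∀ {x y} → x ≈ y → x ≃ y
  ≈⇒≃ {x} {y} t = ≃⟨ ≈r⟨ eqZ⇒≈Z _ _ t ⟩ ⟩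
  ≃⇒≈ : ∀ {x y} → x ≃ y → x ≈ y
  ≃⇒≈ {x} {y} ≃⟨ ≈r⟨ h ⟩ ⟩ = ≈Z⇒eqZ _ _ h
  ≤⇒≤q : ∀ {x y} → x ≤ y → x ≤q y
  ≤⇒≤q {x} {y} t = ≤⟨ geZ⇒NonNegZ (mulZ (proj₁ (subR (raw y) (raw x))) (proj₂ (subR (raw y) (raw x)))) t ⟩
  ≤q⇒≤ : ∀ {x y} → x ≤q y → x ≤ y
  ≤q⇒≤ {x} {y} ≤⟨ h ⟩ = NonNegZ⇒geZ (mulZ (proj₁ (subR (raw y) (raw x))) (proj₂ (subR (raw y) (raw x)))) h

  +q-congL : ∀ {x x'} y → x ≃ x' → (x +q y) ≃ (x' +q y)
  +q-congL {frac n d _} {frac n' d' _} (frac m e _) ≃⟨ ≈r⟨ h ⟩ ⟩ = ≃⟨ ≈r⟨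
    ≈Ztrans (zsolve 6 (λ n d n' d' m e → ((((n ⊠ e) ⊞ (d ⊠ m)) ⊠ (d' ⊠ e)) ≐ (((n ⊠ d') ⊠ (e ⊠ e)) ⊞ ((d ⊠ m) ⊠ (d' ⊠ e))))) ≈Zrefl n d n' d' m e)
      (≈Ztrans (+Z-cong (*Z-cong h (≈Zrefl {mulZ e e})) (≈Zrefl {mulZ (mulZ d m) (mulZ d' e)}))
          (zsolve 6 (λ n d n' d' m e → ((((d ⊠ n') ⊠ (e ⊠ e)) ⊞ ((d ⊠ m) ⊠ (d' ⊠ e))) ≐ ((d ⊠ e) ⊠ ((n' ⊠ e) ⊞ (d' ⊠ m))))) ≈Zrefl n d n' d' m e)) ⟩ ⟩

  x-x≃0 : ∀ x → (x -q x) ≃ 0q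
  x-x≃0 (frac a b _) = ≃⟨ ≈r⟨ zsolve 2 (λ a b → subP (a , b) (a , b) ≐q zeroP) ≈Zrefl a b ⟩ ⟩

  sub-split : ∀ z y x → (z -q x) ≃ ((z -q y) +q (y -q x))
  sub-split (frac a b _) (frac e f _) (frac c d _) = ≃⟨ ≈r⟨ zsolve 6 (λ a b c d e f → subP (a , b) (c , d) ≐q addP (subP (a , b) (e , f)) (subP (e , f) (c , d))) ≈Zrefl a b c d e f ⟩ ⟩

  neg-sub : ∀ y x → negq (y -q x) ≃ (x -q y)
  neg-sub (frac a b _) (frac c d _) = ≃⟨ ≈r⟨ zsolve 4 (λ a b c d → negP (subP (a , b) (c , d)) ≐q subP (c , d) (a , b)) ≈Zrefl a b c d ⟩ ⟩

  +q-comm : ∀ x y → (x +q y) ≃ (y +q x)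
  +q-comm (frac a b _) (frac c d _) = ≃⟨ ≈r⟨ zsolve 4 (λ a b c d → addP (a , b) (c , d) ≐q addP (c , d) (a , b)) ≈Zrefl a b c d ⟩ ⟩

  sub≃+neg : ∀ x y → (x -q y) ≃ (x +q negq y)
  sub≃+neg (frac a b _) (frac c d _) = ≃⟨ ≈r⟨ zsolve 4 (λ a b c d → subP (a , b) (c , d) ≐q addP (a , b) (negP (c , d))) ≈Zrefl a b c d ⟩ ⟩

  +q-identityˡ : ∀ x → (0q +q x) ≃ x
  +q-identityˡ (frac a b _) = ≃⟨ ≈r⟨ zsolve 2 (λ a b → addP zeroP (a , b) ≐q (a , b)) ≈Zrefl a b ⟩ ⟩

  sub-+-cancel : ∀ y x → ((y -q x) +q x) ≃ y
  sub-+-cancel (frac a b _) (frac c d _) = ≃⟨ ≈r⟨ zsolve 4 (λ a b c d → addP (subP (a , b) (c , d)) (c , d) ≐q (a , b)) ≈Zrefl a b c d ⟩ ⟩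

  +q-sub-+q : ∀ y z x → ((y +q z) -q (x +q z)) ≃ (y -q x)
  +q-sub-+q (frac a b _) (frac e f _) (frac c d _) = ≃⟨ ≈r⟨ zsolve 6 (λ a b c d e f → subP (addP (a , b) (e , f)) (addP (c , d) (e , f)) ≐q subP (a , b) (c , d)) ≈Zrefl a b c d e f ⟩ ⟩

  half+half : ∀ x → (halfq x +q halfq x) ≃ x
  half+half (frac a b _) = ≃⟨ ≈r⟨ zsolve 2 (λ a b → addP (halfP (a , b)) (halfP (a , b)) ≐q (a , b)) ≈Zrefl a b ⟩ ⟩

  sub-0 : ∀ x → (x -q 0q) ≃ x
  sub-0 (frac a b _) = ≃⟨ ≈r⟨ zsolve 2 (λ a b → subP (a , b) zeroP ≐q (a , b)) ≈Zrefl a b ⟩ ⟩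

  0-sub : ∀ x → (0q -q x) ≃ negq x
  0-sub (frac a b _) = ≃⟨ ≈r⟨ zsolve 2 (λ a b → subP zeroP (a , b) ≐q negP (a , b)) ≈Zrefl a b ⟩ ⟩

  +q-congR : ∀ x {y y'} → y ≃ y' → (x +q y) ≃ (x +q y')
  +q-congR x {y} {y'} h = ≃-trans (+q-comm x y) (≃-trans (+q-congL x h) (+q-comm y' x))

  +q-cong : ∀ {x x' y y'} → x ≃ x' → y ≃ y' → (x +q y) ≃ (x' +q y')
  +q-cong {x} {x'} {y} {y'} h k = ≃-trans (+q-congL y h) (+q-congR x' k)

  negq-cong : ∀ {x x'} → x ≃ x' → negq x ≃ negq x'
  negq-cong {frac n d _} {frac n' d' _} ≃⟨ ≈r⟨ h ⟩ ⟩ = ≃⟨ ≈r⟨ ≈Ztrans (zsolve 2 (λ n d' → ((:- n) ⊠ d') ≐ (:- (n ⊠ d'))) ≈Zrefl n d')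
       (≈Ztrans (-Z-cong h) (zsolve 2 (λ d n' → (:- (d ⊠ n')) ≐ (d ⊠ (:- n'))) ≈Zrefl d n')) ⟩ ⟩

  -q-cong : ∀ {x x' y y'} → x ≃ x' → y ≃ y' → (x -q y) ≃ (x' -q y')
  -q-cong {x} {x'} {y} {y'} h k = ≃-trans (sub≃+neg x y) (≃-trans (+q-cong h (negq-cong k)) (≃-sym (sub≃+neg x' y')))

  +q-sub-cancelˡ : ∀ a b → ((a +q b) -q a) ≃ b
  +q-sub-cancelˡ (frac a b _) (frac c d _) = ≃⟨ ≈r⟨ zsolve 4 (λ a b c d → subP (addP (a , b) (c , d)) (a , b) ≐q (c , d)) ≈Zrefl a b c d ⟩ ⟩

  NonNegQ-+ : ∀ x y → NonNegQ x → NonNegQ y → NonNegQ (x +q y)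
  NonNegQ-+ x y = NonNegR-+ {raw x} {raw y}

  NonNegQ-antisym : ∀ x → NonNegQ x → NonNegQ (negq x) → x ≃ 0q
  NonNegQ-antisym x h1 h2 = ≃⟨ NonNegR-antisym {raw x} (den≉0 x) h1 h2 ⟩

  ≃-dec : ∀ x y → Dec (x ≃ y)
  ≃-dec x y with mulZ (proj₁ (raw x)) (proj₂ (raw y)) ≟Z mulZ (proj₂ (raw x)) (proj₁ (raw y))
  ... | yes h = yes ≃⟨ ≈r⟨ h ⟩ ⟩
  ... | no n = no λ { ≃⟨ ≈r⟨ h ⟩ ⟩ → n h }

  sub≃0⇒≃ : ∀ {x y} → (y -q x) ≃ 0q → x ≃ y
  sub≃0⇒≃ {x} {y} e = ≃-sym (≃-trans (≃-sym (sub-+-cancel y x)) (≃-trans (+q-congL x e) (+q-identityˡ x)))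

  ≃⇒sub≃0 : ∀ {x y} → x ≃ y → (y -q x) ≃ 0q
  ≃⇒sub≃0 {x} {y} e = ≃-trans (-q-cong (≃-refl {y}) (e)) (x-x≃0 y)

  ≤-refl : ∀ {x} → x ≤q x
  ≤-refl {x} = ≤⟨ NonNegQ-resp (≃-sym (x-x≃0 x)) NonNegR-0 ⟩

  ≃⇒≤ : ∀ {x y} → x ≃ y → x ≤q y
  ≃⇒≤ {x} {y} e = ≤⟨ NonNegQ-resp (≃-sym (≃⇒sub≃0 e)) NonNegR-0 ⟩

  ≤-trans : ∀ {x y z} → x ≤q y → y ≤q z → x ≤q z
  ≤-trans {x} {y} {z} ≤⟨ h ⟩ ≤⟨ k ⟩ = ≤⟨ NonNegQ-resp (≃-sym (sub-split z y x)) (NonNegQ-+ (z -q y) (y -q x) k h) ⟩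

  ≤-total : ∀ x y → x ≤q y ⊎ y ≤q x
  ≤-total x y with NonNegR-total (raw (y -q x))
  ... | inj₁ h = inj₁ ≤⟨ h ⟩
  ... | inj₂ h = inj₂ ≤⟨ NonNegQ-resp {negq (y -q x)} (neg-sub y x) h ⟩

  ≤-anti : ∀ {x y} → x ≤q y → y ≤q x → x ≃ y
  ≤-anti {x} {y} ≤⟨ h ⟩ ≤⟨ k ⟩ = sub≃0⇒≃ (NonNegQ-antisym (y -q x) h (NonNegQ-resp (≃-sym (neg-sub y x)) k))

  ≤-resp : ∀ {x x' y y'} → x ≃ x' → y ≃ y' → x ≤q y → x' ≤q y'
  ≤-resp h k ≤⟨ n ⟩ = ≤⟨ NonNegQ-resp (-q-cong k h) n ⟩

  <-resp : ∀ {x x' y y'} → x ≃ x' → y ≃ y' → x <q y → x' <q y'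
  <-resp h k <⟨ n ⟩ = <⟨ PosQ-resp (-q-cong k h) n ⟩

  <⇒≤ : ∀ {x y} → x <q y → x ≤q y
  <⇒≤ <⟨ n , _ ⟩ = ≤⟨ n ⟩

  <⇒≄ : ∀ {x y} → x <q y → ¬ x ≃ y
  <⇒≄ <⟨ _ , nz ⟩ e = nz (≃⇒sub≃0 e)

  PosQ-+-NonNegQ : ∀ a b → PosQ a → NonNegQ b → PosQ (a +q b)
  PosQ-+-NonNegQ a b (na , nza) nb = NonNegQ-+ a b na nb , λ e →
    nza (NonNegQ-antisym a na (NonNegQ-resp (≃-trans (≃-sym (+q-sub-cancelˡ a b)) (≃-trans (-q-cong e (≃-refl {a})) (0-sub a))) nb))

  ≤<-trans : ∀ {x y z} → x ≤q y → y <q z → x <q z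
  ≤<-trans {x} {y} {z} ≤⟨ h ⟩ <⟨ k ⟩ = <⟨ PosQ-resp (≃-sym (sub-split z y x)) (PosQ-+-NonNegQ (z -q y) (y -q x) k h) ⟩

  <≤-trans : ∀ {x y z} → x <q y → y ≤q z → x <q z
  <≤-trans {x} {y} {z} <⟨ h ⟩ ≤⟨ k ⟩ = <⟨ PosQ-resp (≃-trans (+q-comm (y -q x) (z -q y)) (≃-sym (sub-split z y x))) (PosQ-+-NonNegQ (y -q x) (z -q y) h k) ⟩

  <-trans : ∀ {x y z} → x <q y → y <q z → x <q z
  <-trans h k = ≤<-trans (<⇒≤ h) k

  <-irrefl : ∀ {x} → ¬ x <q x
  <-irrefl h = <⇒≄ h ≃-refl

  lt-or-ge : ∀ x y → x <q y ⊎ y ≤q x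
  lt-or-ge x y with ≤-total x y
  ... | inj₂ h = inj₂ h
  ... | inj₁ ≤⟨ h ⟩ with ≃-dec x y
  ...   | yes e = inj₂ (≃⇒≤ (≃-sym e))
  ...   | no n = inj₁ <⟨ h , (λ e → n (sub≃0⇒≃ e)) ⟩

  ¬<⇒≥ : ∀ {x y} → ¬ x <q y → y ≤q x
  ¬<⇒≥ {x} {y} n with lt-or-ge x y
  ... | inj₁ h = ⊥-elim (n h)
  ... | inj₂ h = h

  ≤<-contra : ∀ {x y} → x ≤q y → y <q x → ⊥
  ≤<-contra h k = <-irrefl (≤<-trans h k)

  +q-monoˡ-< : ∀ {x y} z → x <q y → (x +q z) <q (y +q z)
  +q-monoˡ-< {x} {y} z <⟨ h ⟩ = <⟨ PosQ-resp (≃-sym (+q-sub-+q y z x)) h ⟩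

  <⇒<q : ∀ {x y} → x < y → x <q y
  <⇒<q {x} {y} t = <⟨ un≤ (≤⇒≤q {x} {y} x≤y) , (λ e → T-not⇒¬T x≉y (≃⇒≈ {x} {y} (sub≃0⇒≃ e))) ⟩
    where
    x≤y = proj₁ (Equivalence.to T-∧ t)
    x≉y = proj₂ (Equivalence.to T-∧ t)
  <q⇒< : ∀ {x y} → x <q y → x < y
  <q⇒< {x} {y} h = Equivalence.from T-∧ (≤q⇒≤ {x} {y} (<⇒≤ h) , ¬T⇒T-not (λ t → <⇒≄ h (≈⇒≃ {x} {y} t)))

  0+0 : (0q +q 0q) ≃ 0q
  0+0 = +q-identityˡ 0q

  PosQ-half : ∀ x → PosQ x → PosQ (halfq x)
  PosQ-half (frac n d p) (nn , nz) =
    NonNegZ-resp (zsolve 2 (λ n d → ((n ⊠ d) ⊞ (n ⊠ d)) ≐ (n ⊠ (d ⊞ d))) ≈Zrefl n d) (NonNegZ-+ {mulZ n d} {mulZ n d} nn nn) ,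
    λ e → nz (≃-trans (≃-sym (half+half (frac n d p))) (≃-trans (+q-cong e e) 0+0))

  0<⇒PosQ : ∀ {w} → 0q <q w → PosQ w
  0<⇒PosQ {w} <⟨ h ⟩ = PosQ-resp (sub-0 w) h
  PosQ⇒0< : ∀ {w} → PosQ w → 0q <q w
  PosQ⇒0< {w} h = <⟨ PosQ-resp (≃-sym (sub-0 w)) h ⟩

  sub-sub-cancel : ∀ x r → (x -q (x -q r)) ≃ r
  sub-sub-cancel (frac a b _) (frac c d _) = ≃⟨ ≈r⟨ zsolve 4 (λ a b c d → subP (a , b) (subP (a , b) (c , d)) ≐q (c , d)) ≈Zrefl a b c d ⟩ ⟩

  sub-pos-< : ∀ x r → PosQ r → (x -q r) <q x
  sub-pos-< x r h = <⟨ PosQ-resp (≃-sym (sub-sub-cancel x r)) h ⟩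
  <-+-pos : ∀ x r → PosQ r → x <q (x +q r)
  <-+-pos x r h = <⟨ PosQ-resp (≃-sym (+q-sub-cancelˡ x r)) h ⟩

  midpoint-sub-lower : ∀ u w → (halfq (u +q w) -q u) ≃ halfq (w -q u)
  midpoint-sub-lower (frac (a₁ , a₂) (b₁ , b₂) _) (frac (c₁ , c₂) (d₁ , d₂) _) = ≃⟨ ≈r⟨ ≈Z⟨ nsolve 8 (λ a₁ a₂ b₁ b₂ c₁ c₂ d₁ d₂ →
    subRP (halfRP (addRP ((a₁ , a₂) , (b₁ , b₂)) ((c₁ , c₂) , (d₁ , d₂)))) ((a₁ , a₂) , (b₁ , b₂)) ≐RP halfRP (subRP ((c₁ , c₂) , (d₁ , d₂)) ((a₁ , a₂) , (b₁ , b₂))))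
    ≈Nrefl a₁ a₂ b₁ b₂ c₁ c₂ d₁ d₂ ⟩ ⟩ ⟩
  upper-sub-midpoint : ∀ u w → (w -q halfq (u +q w)) ≃ halfq (w -q u)
  upper-sub-midpoint (frac (a₁ , a₂) (b₁ , b₂) _) (frac (c₁ , c₂) (d₁ , d₂) _) = ≃⟨ ≈r⟨ ≈Z⟨ nsolve 8 (λ a₁ a₂ b₁ b₂ c₁ c₂ d₁ d₂ →
    subRP ((c₁ , c₂) , (d₁ , d₂)) (halfRP (addRP ((a₁ , a₂) , (b₁ , b₂)) ((c₁ , c₂) , (d₁ , d₂)))) ≐RP halfRP (subRP ((c₁ , c₂) , (d₁ , d₂)) ((a₁ , a₂) , (b₁ , b₂))))
    ≈Nrefl a₁ a₂ b₁ b₂ c₁ c₂ d₁ d₂ ⟩ ⟩ ⟩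

  <-midpoint : ∀ {u w} → u <q w → u <q halfq (u +q w)
  <-midpoint {u} {w} <⟨ h ⟩ = <⟨ PosQ-resp (≃-sym (midpoint-sub-lower u w)) (PosQ-half (w -q u) h) ⟩
  midpoint-< : ∀ {u w} → u <q w → halfq (u +q w) <q w
  midpoint-< {u} {w} <⟨ h ⟩ = <⟨ PosQ-resp (≃-sym (upper-sub-midpoint u w)) (PosQ-half (w -q u) h) ⟩

  sub-+-sub : ∀ b e a c → ((b +q e) -q (a +q c)) ≃ ((b -q a) +q (e -q c))
  sub-+-sub (frac b1 b2 _) (frac e1 e2 _) (frac a1 a2 _) (frac c1 c2 _) = ≃⟨ ≈r⟨ zsolve 8 (λ b1 b2 e1 e2 a1 a2 c1 c2 →
    subP (addP (b1 , b2) (e1 , e2)) (addP (a1 , a2) (c1 , c2)) ≐q addP (subP (b1 , b2) (a1 , a2)) (subP (e1 , e2) (c1 , c2))) ≈Zrefl b1 b2 e1 e2 a1 a2 c1 c2 ⟩ ⟩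

  sub-sub-sub : ∀ s i q p → ((s -q i) -q (q -q p)) ≃ ((s -q q) +q (p -q i))
  sub-sub-sub (frac s1 s2 _) (frac i1 i2 _) (frac q1 q2 _) (frac p1 p2 _) = ≃⟨ ≈r⟨ zsolve 8 (λ s1 s2 i1 i2 q1 q2 p1 p2 →
    subP (subP (s1 , s2) (i1 , i2)) (subP (q1 , q2) (p1 , p2)) ≐q addP (subP (s1 , s2) (q1 , q2)) (subP (p1 , p2) (i1 , i2))) ≈Zrefl s1 s2 i1 i2 q1 q2 p1 p2 ⟩ ⟩

  +q-sub-cancelʳ : ∀ z a → z ≃ (a +q (z -q a))
  +q-sub-cancelʳ (frac z1 z2 _) (frac a1 a2 _) = ≃⟨ ≈r⟨ zsolve 4 (λ z1 z2 a1 a2 → (z1 , z2) ≐q addP (a1 , a2) (subP (z1 , z2) (a1 , a2))) ≈Zrefl z1 z2 a1 a2 ⟩ ⟩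

  sub-sub-cancelˡ : ∀ z a b → ((z -q a) -q (z -q b)) ≃ (b -q a)
  sub-sub-cancelˡ (frac z1 z2 _) (frac a1 a2 _) (frac b1 b2 _) = ≃⟨ ≈r⟨ zsolve 6 (λ z1 z2 a1 a2 b1 b2 →
    subP (subP (z1 , z2) (a1 , a2)) (subP (z1 , z2) (b1 , b2)) ≐q subP (b1 , b2) (a1 , a2)) ≈Zrefl z1 z2 a1 a2 b1 b2 ⟩ ⟩

  +q-sub-sub : ∀ x r → ((x +q r) -q (x -q r)) ≃ (r +q r)
  +q-sub-sub (frac x1 x2 _) (frac r1 r2 _) = ≃⟨ ≈r⟨ zsolve 4 (λ x1 x2 r1 r2 →
    subP (addP (x1 , x2) (r1 , r2)) (subP (x1 , x2) (r1 , r2)) ≐q addP (r1 , r2) (r1 , r2)) ≈Zrefl x1 x2 r1 r2 ⟩ ⟩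

  half-sub-half : ∀ y x → (halfq y -q halfq x) ≃ halfq (y -q x)
  half-sub-half (frac (y₁ , y₂) (y₃ , y₄) _) (frac (x₁ , x₂) (x₃ , x₄) _) = ≃⟨ ≈r⟨ ≈Z⟨ nsolve 8 (λ y₁ y₂ y₃ y₄ x₁ x₂ x₃ x₄ →
    subRP (halfRP ((y₁ , y₂) , (y₃ , y₄))) (halfRP ((x₁ , x₂) , (x₃ , x₄))) ≐RP halfRP (subRP ((y₁ , y₂) , (y₃ , y₄)) ((x₁ , x₂) , (x₃ , x₄))))
    ≈Nrefl y₁ y₂ y₃ y₄ x₁ x₂ x₃ x₄ ⟩ ⟩ ⟩

  +q-mono-< : ∀ {a b c e} → a <q b → c <q e → (a +q c) <q (b +q e)
  +q-mono-< {a} {b} {c} {e} a<b c<e = <-trans (+q-monoˡ-< c a<b) (<-resp (+q-comm c b) (+q-comm e b) (+q-monoˡ-< b c<e))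

  -q-mono-< : ∀ {q s p i} → q <q s → i <q p → (q -q p) <q (s -q i)
  -q-mono-< {q} {s} {p} {i} <⟨ s-q>0 ⟩ i<p =
    <⟨ PosQ-resp (≃-sym (sub-sub-sub s i q p)) (PosQ-+-NonNegQ (s -q q) (p -q i) s-q>0 (un≤ (<⇒≤ i<p))) ⟩

  -q-mono-≤ : ∀ {e v u c} → e ≤q v → u ≤q c → (e -q c) ≤q (v -q u)
  -q-mono-≤ {e} {v} {u} {c} ≤⟨ v-e≥0 ⟩ ≤⟨ c-u≥0 ⟩ =
    ≤⟨ NonNegQ-resp (≃-sym (sub-sub-sub v u e c)) (NonNegQ-+ (v -q e) (c -q u) v-e≥0 c-u≥0) ⟩

  half-mono-< : ∀ {x y} → x <q y → halfq x <q halfq y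
  half-mono-< {x} {y} <⟨ y-x>0 ⟩ = <⟨ PosQ-resp (≃-sym (half-sub-half y x)) (PosQ-half (y -q x) y-x>0) ⟩

  sub-sub-swap : ∀ x r y → (y -q (x -q r)) ≃ (r -q (x -q y))
  sub-sub-swap (frac a b _) (frac c d _) (frac e f _) = ≃⟨ ≈r⟨ zsolve 6 (λ a b c d e f → subP (e , f) (subP (a , b) (c , d)) ≐q subP (c , d) (subP (a , b) (e , f))) ≈Zrefl a b c d e f ⟩ ⟩
  +q-sub-swap : ∀ x r y → ((x +q r) -q y) ≃ (r -q (y -q x))
  +q-sub-swap (frac a b _) (frac c d _) (frac e f _) = ≃⟨ ≈r⟨ zsolve 6 (λ a b c d e f → subP (addP (a , b) (c , d)) (e , f) ≐q subP (c , d) (subP (e , f) (a , b))) ≈Zrefl a b c d e f ⟩ ⟩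
  sub-neg-self : ∀ t → (t -q negq t) ≃ (t +q t)
  sub-neg-self (frac a b _) = ≃⟨ ≈r⟨ zsolve 2 (λ a b → subP (a , b) (negP (a , b)) ≐q addP (a , b) (a , b)) ≈Zrefl a b ⟩ ⟩
  neg-sub-self : ∀ t → (negq t -q t) ≃ (negq t +q negq t)
  neg-sub-self (frac a b _) = ≃⟨ ≈r⟨ zsolve 2 (λ a b → subP (negP (a , b)) (a , b) ≐q addP (negP (a , b)) (negP (a , b))) ≈Zrefl a b ⟩ ⟩

  absR-cases : ∀ p → (T (nonnegR p) × absR p ≡ p) ⊎ (¬ T (nonnegR p) × absR p ≡ negR p)
  absR-cases p with nonnegR p
  ... | true = inj₁ (tt , refl)
  ... | false = inj₂ ((λ ()) , refl)

  absR<⇒ : ∀ t r → T (ltR (absR (raw t)) (raw r)) → (t <q r) × (negq t <q r)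
  absR<⇒ t r h with absR-cases (raw t)
  ... | inj₁ (nn , e) = <⇒<q {t} {r} h' , ≤<-trans {negq t} {t} {r} ≤⟨ NonNegQ-resp (≃-sym (sub-neg-self t)) (NonNegQ-+ t t nt nt) ⟩ (<⇒<q {t} {r} h')
    where h' : t < r
          h' = subst (λ q → T (ltR q (raw r))) e h
          nt : NonNegQ t
          nt = geZ⇒NonNegZ (mulZ (proj₁ (raw t)) (proj₂ (raw t))) nn
  ... | inj₂ (nn , e) = ≤<-trans {t} {negq t} {r} ≤⟨ NonNegQ-resp (≃-sym (neg-sub-self t)) (NonNegQ-+ (negq t) (negq t) nnt nnt) ⟩ (<⇒<q {negq t} {r} h') , <⇒<q {negq t} {r} h'
    where h' : negq t < r
          h' = subst (λ q → T (ltR q (raw r))) e h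
          nnt : NonNegQ (negq t)
          nnt with NonNegR-total (raw t)
          ... | inj₂ k = k
          ... | inj₁ k = ⊥-elim (nn (NonNegZ⇒geZ (mulZ (proj₁ (raw t)) (proj₂ (raw t))) k))

  <⇒absR< : ∀ t r → t <q r → negq t <q r → T (ltR (absR (raw t)) (raw r))
  <⇒absR< t r h1 h2 with absR-cases (raw t)
  ... | inj₁ (_ , e) = subst (λ q → T (ltR q (raw r))) (sym e) (<q⇒< {t} {r} h1)
  ... | inj₂ (_ , e) = subst (λ q → T (ltR q (raw r))) (sym e) (<q⇒< {negq t} {r} h2)

  sub<⇒lower< : ∀ {x y r} → (x -q y) <q r → (x -q r) <q y
  sub<⇒lower< {x} {y} {r} <⟨ h ⟩ = <⟨ PosQ-resp (≃-sym (sub-sub-swap x r y)) h ⟩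

  lower<⇒sub< : ∀ {x y r} → (x -q r) <q y → (x -q y) <q r
  lower<⇒sub< {x} {y} {r} <⟨ h ⟩ = <⟨ PosQ-resp (sub-sub-swap x r y) h ⟩

  sub<⇒<upper : ∀ {x y r} → (y -q x) <q r → y <q (x +q r)
  sub<⇒<upper {x} {y} {r} <⟨ h ⟩ = <⟨ PosQ-resp (≃-sym (+q-sub-swap x r y)) h ⟩

  <upper⇒sub< : ∀ {x y r} → y <q (x +q r) → (y -q x) <q r
  <upper⇒sub< {x} {y} {r} <⟨ h ⟩ = <⟨ PosQ-resp (+q-sub-swap x r y) h ⟩

module Cuts (α : Ordinal) where
  open import Data.Product using (Σ; _×_; _,_; proj₁; proj₂)
  open import Data.Sum using (_⊎_; inj₁; inj₂; [_,_]′)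
  open import Data.Empty using (⊥; ⊥-elim)
  open import Data.Bool using (T)
  open import Relation.Nullary using (¬_)
  open Rationals α
  open Arith α

  ball⇒bounds : ∀ x r y → Ball x r y → ((x -q r) <q y) × (y <q (x +q r))
  ball⇒bounds x r y y∈U =
    let (x-y<r , -[x-y]<r) = absR<⇒ (x -q y) r y∈U
    in sub<⇒lower< {x} {y} {r} x-y<r , sub<⇒<upper {x} {y} {r} (<-resp (neg-sub x y) ≃-refl -[x-y]<r)

  bounds⇒ball : ∀ x r y → (x -q r) <q y → y <q (x +q r) → Ball x r y
  bounds⇒ball x r y x-r<y y<x+r =
    <⇒absR< (x -q y) r (lower<⇒sub< {x} {y} {r} x-r<y) (<-resp (≃-sym (neg-sub x y)) ≃-refl (<upper⇒sub< {x} {y} {r} y<x+r))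

  isSup-unique : ∀ {S s s'} → IsSup S s → IsSup S s' → s ≃ s'
  isSup-unique {s = s} {s'} (ub , least) (ub' , least') = ≤-anti (≤⇒≤q {s} {s'} (least s' ub')) (≤⇒≤q {s'} {s} (least' s ub))

  isInf-unique : ∀ {S i i'} → IsInf S i → IsInf S i' → i ≃ i'
  isInf-unique {i = i} {i'} (lb , greatest) (lb' , greatest') = ≤-anti (≤⇒≤q {i} {i'} (greatest' i lb)) (≤⇒≤q {i'} {i} (greatest i' lb'))

  ball-centre : ∀ x r → 0q <q r → Ball x r x
  ball-centre x r r>0 = bounds⇒ball x r x (sub-pos-< x r (0<⇒PosQ r>0)) (<-+-pos x r (0<⇒PosQ r>0))

  ball-isSup : ∀ x r → 0q <q r → IsSup (Ball x r) (x +q r)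
  ball-isSup x r r>0 = upper , least
    where
    upper : ∀ y → Ball x r y → y ≤ (x +q r)
    upper y y∈U = ≤q⇒≤ {y} {x +q r} (<⇒≤ (proj₂ (ball⇒bounds x r y y∈U)))
    least : ∀ u → (∀ y → Ball x r y → y ≤ u) → (x +q r) ≤ u
    least u ub = ≤q⇒≤ {x +q r} {u} (¬<⇒≥ u≮x+r)
      where
      u≮x+r : ¬ u <q (x +q r)
      u≮x+r u<x+r = [ below-centre , above-centre ]′ (lt-or-ge u x)
        where
        below-centre : u <q x → ⊥
        below-centre u<x = ≤<-contra (≤⇒≤q {x} {u} (ub x (ball-centre x r r>0))) u<x
        above-centre : x ≤q u → ⊥
        above-centre x≤u = ≤<-contra (≤⇒≤q {w} {u} (ub w w∈U)) (<-midpoint u<x+r)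
          where
          w : Q
          w = halfq (u +q (x +q r))
          w∈U : Ball x r w
          w∈U = bounds⇒ball x r w (<-trans (<≤-trans (sub-pos-< x r (0<⇒PosQ r>0)) x≤u) (<-midpoint u<x+r)) (midpoint-< u<x+r)

  ball-isInf : ∀ x r → 0q <q r → IsInf (Ball x r) (x -q r)
  ball-isInf x r r>0 = lower , greatest
    where
    lower : ∀ y → Ball x r y → (x -q r) ≤ y
    lower y y∈U = ≤q⇒≤ {x -q r} {y} (<⇒≤ (proj₁ (ball⇒bounds x r y y∈U)))
    greatest : ∀ u → (∀ y → Ball x r y → u ≤ y) → u ≤ (x -q r)
    greatest u lb = ≤q⇒≤ {u} {x -q r} (¬<⇒≥ x-r≮u)
      where
      x-r≮u : ¬ (x -q r) <q u
      x-r≮u x-r<u = [ above-centre , below-centre ]′ (lt-or-ge x u)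
        where
        above-centre : x <q u → ⊥
        above-centre x<u = ≤<-contra (≤⇒≤q {u} {x} (lb x (ball-centre x r r>0))) x<u
        below-centre : u ≤q x → ⊥
        below-centre u≤x = ≤<-contra (≤⇒≤q {u} {w} (lb w w∈U)) (midpoint-< x-r<u)
          where
          w : Q
          w = halfq ((x -q r) +q u)
          w∈U : Ball x r w
          w∈U = bounds⇒ball x r w (<-midpoint x-r<u) (<-trans (<≤-trans (midpoint-< x-r<u) u≤x) (<-+-pos x r (0<⇒PosQ r>0)))

  DiameterAbove : Q → Q → Q → Set
  DiameterAbove d x r = Σ Q λ s → Σ Q λ i → IsSup (Ball x r) s × IsInf (Ball x r) i × T (ltR (raw d) (subR (raw s) (raw i)))

  Separated : Q → Subset → Subset → Set
  Separated d X Y = ∀ x y → X x → Y y → d ≤q (y -q x)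

  separated⇒improper : ∀ {d X Y} → Positive d → Separated d X Y → Improper X Y
  separated⇒improper {d} d>0 separated = d , d>0 , wide
    where
    wide : ∀ x r → Positive r → Meets (Ball x r) _ → Meets (Ball x r) _ → DiameterAbove d x r
    wide x r r>0 (p , p∈U , Xp) (q , q∈U , Yq) =
      x +q r , x -q r , ball-isSup x r (<⇒<q r>0) , ball-isInf x r (<⇒<q r>0) , <q⇒< {d} {(x +q r) -q (x -q r)} d<diameter
      where
      d<diameter : d <q ((x +q r) -q (x -q r))
      d<diameter = ≤<-trans (separated p q Xp Yq) (-q-mono-< (proj₂ (ball⇒bounds x r q q∈U)) (proj₁ (ball⇒bounds x r p p∈U)))

  -- Were some x ∈ X and y ∈ Y closer than d, the ball around their midpoint whose radius lies
  -- halfway between (y - x)/2 and d/2 would meet both sides and still have diameter below d.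
  improper⇒separated : ∀ {X Y} → (∀ x y → X x → Y y → x < y) → (improper : Improper X Y) → Separated (proj₁ improper) X Y
  improper⇒separated X<Y (d , d>0 , wide) x y Xx Yy = ¬<⇒≥ y-x≮d
    where
    y-x≮d : ¬ (y -q x) <q d
    y-x≮d y-x<d = <-irrefl (<-trans d<ρ+ρ ρ+ρ<d)
      where
      x<y : x <q y
      x<y = <⇒<q {x} {y} (X<Y x y Xx Yy)
      h m ρ : Q
      h = halfq (y -q x)
      m = halfq (x +q y)
      ρ = halfq (h +q halfq d)
      h<d/2 : h <q halfq d
      h<d/2 = half-mono-< y-x<d
      h<ρ : h <q ρ
      h<ρ = <-midpoint h<d/2
      ρ>0 : 0q <q ρ
      ρ>0 = <-trans (PosQ⇒0< (PosQ-half (y -q x) (un< x<y))) h<ρ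
      x∈U : Ball m ρ x
      x∈U = bounds⇒ball m ρ x (sub<⇒lower< {m} {x} {ρ} (<-resp (≃-sym (midpoint-sub-lower x y)) ≃-refl h<ρ))
                              (<-trans (<-midpoint x<y) (<-+-pos m ρ (0<⇒PosQ ρ>0)))
      y∈U : Ball m ρ y
      y∈U = bounds⇒ball m ρ y (<-trans (sub-pos-< m ρ (0<⇒PosQ ρ>0)) (midpoint-< x<y))
                              (sub<⇒<upper {m} {y} {ρ} (<-resp (≃-sym (upper-sub-midpoint x y)) ≃-refl h<ρ))
      d<ρ+ρ : d <q (ρ +q ρ)
      d<ρ+ρ = d<diameter (wide m ρ (<q⇒< {0q} {ρ} ρ>0) (x , x∈U , Xx) (y , y∈U , Yy))
        where
        d<diameter : DiameterAbove d m ρ → d <q (ρ +q ρ)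
        d<diameter (s , i , s-sup , i-inf , d<s-i) = <-resp ≃-refl s-i≃ρ+ρ (<⇒<q {d} {s -q i} d<s-i)
          where
          s-i≃ρ+ρ : (s -q i) ≃ (ρ +q ρ)
          s-i≃ρ+ρ = ≃-trans (-q-cong (isSup-unique {Ball m ρ} {s} {m +q ρ} s-sup (ball-isSup m ρ ρ>0))
                                     (isInf-unique {Ball m ρ} {i} {m -q ρ} i-inf (ball-isInf m ρ ρ>0)))
                            (+q-sub-sub m ρ)
      ρ+ρ<d : (ρ +q ρ) <q d
      ρ+ρ<d = <-resp (≃-sym (half+half (h +q halfq d))) (half+half d) (+q-monoˡ-< (halfq d) h<d/2)

  +ₛ-respects : ∀ X Y → Respects (X +ₛ Y)
  +ₛ-respects X Y z z' z≈z' (x , y , Xx , Yy , z=x+y) =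
    x , y , Xx , Yy , ≃⇒≈ {z'} {x +q y} (≃-trans (≃-sym (≈⇒≃ {z} {z'} z≈z')) (≈⇒≃ {z} {x +q y} z=x+y))

  +ₛ-below : ∀ {A B C D} → (∀ a b → A a → B b → a < b) → (∀ c e → C c → D e → c < e) →
             ∀ z w → (A +ₛ C) z → (B +ₛ D) w → z < w
  +ₛ-below A<B C<D z w (a , c , Aa , Cc , z=a+c) (b , e , Bb , De , w=b+e) =
    <q⇒< {z} {w} (<-resp (≃-sym (≈⇒≃ {z} {a +q c} z=a+c)) (≃-sym (≈⇒≃ {w} {b +q e} w=b+e))
                       (+q-mono-< (<⇒<q {a} {b} (A<B a b Aa Bb)) (<⇒<q {c} {e} (C<D c e Cc De))))

  +ₛ-noMax : ∀ {X} Y → (∀ s → IsSup X s → ¬ X s) → ∀ s → IsSup (X +ₛ Y) s → ¬ (X +ₛ Y) s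
  +ₛ-noMax {X} Y noMax s (upper , _) (a , c , Xa , Yc , s=a+c) = noMax a (a-max , λ u ub → ub a Xa) Xa
    where
    a-max : ∀ y → X y → y ≤ a
    a-max y Xy = ≤q⇒≤ {y} {a} (¬<⇒≥ λ a<y → ≤<-contra (≤⇒≤q {y +q c} {s} (upper (y +q c) (y , c , Xy , Yc , ≃⇒≈ {y +q c} {y +q c} ≃-refl)))
                                                    (<-resp (≃-sym (≈⇒≃ {s} {a +q c} s=a+c)) ≃-refl (+q-monoˡ-< c a<y)))

  +ₛ-noMin : ∀ {X} Y → (∀ i → IsInf X i → ¬ X i) → ∀ i → IsInf (X +ₛ Y) i → ¬ (X +ₛ Y) i
  +ₛ-noMin {X} Y noMin i (lower , _) (b , e , Xb , Ye , i=b+e) = noMin b (b-min , λ u lb → lb b Xb) Xb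
    where
    b-min : ∀ y → X y → b ≤ y
    b-min y Xy = ≤q⇒≤ {b} {y} (¬<⇒≥ λ y<b → ≤<-contra (≤⇒≤q {i} {y +q e} (lower (y +q e) (y , e , Xy , Ye , ≃⇒≈ {y +q e} {y +q e} ≃-refl)))
                                                    (<-resp ≃-refl (≃-sym (≈⇒≃ {i} {b +q e} i=b+e)) (+q-monoˡ-< e y<b)))

  +ₛ-isCut : ∀ {A B C D} → IsCut A B → IsCut C D → (∀ z → ¬ ¬ ((A +ₛ C) z ⊎ (B +ₛ D) z)) → IsCut (A +ₛ C) (B +ₛ D)
  +ₛ-isCut {A} {B} {C} {D} cutAB cutCD covered = record
    { respA = +ₛ-respects A C
    ; respB = +ₛ-respects B D
    ; A<B = +ₛ-below AB.A<B CD.A<B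
    ; gap≤1 = λ x _ x∉ _ → ⊥-elim (covered x x∉)
    ; infB∉B = +ₛ-noMin D AB.infB∉B
    ; supA∉A = +ₛ-noMax C AB.supA∉A
    ; disjoint = λ z ACz BDz → <-irrefl (<⇒<q {z} {z} (+ₛ-below AB.A<B CD.A<B z z ACz BDz))
    }
    where
    module AB = IsCut cutAB
    module CD = IsCut cutCD

  +ₛ-separated : ∀ {A B C D d} → (∀ a b → A a → B b → a < b) → Separated d C D → Separated d (A +ₛ C) (B +ₛ D)
  +ₛ-separated A<B separated z w (a , c , Aa , Cc , z=a+c) (b , e , Bb , De , w=b+e) =
    ≤-trans (separated c e Cc De) (≤-resp ≃-refl w-z≃ (<⇒≤ e-c<b-a+e-c))
    where
    e-c<b-a+e-c : (e -q c) <q ((b -q a) +q (e -q c))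
    e-c<b-a+e-c = <-resp (+q-identityˡ (e -q c)) ≃-refl (+q-monoˡ-< (e -q c) (PosQ⇒0< (un< (<⇒<q {a} {b} (A<B a b Aa Bb)))))
    w-z≃ : ((b -q a) +q (e -q c)) ≃ (w -q z)
    w-z≃ = ≃-sym (≃-trans (-q-cong (≈⇒≃ {w} {b +q e} w=b+e) (≈⇒≃ {z} {a +q c} z=a+c)) (sub-+-sub b e a c))

  -- A point z missed by both sums has z - a ∉ C and z - b ∉ D for a ∈ A, b ∈ B. If b - a < d, then
  -- a' > a in A and b' < b in B would give two points z - b < z - b' outside D and two points
  -- z - a' < z - a outside C; since (C, D) leaves at most one point uncovered, C would contain some
  -- c ≥ z - b and D some e ≤ z - a, although e - c ≤ b - a < d. So a is the maximum of A or b the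
  -- minimum of B, which a cut forbids.
  gap⇒separated : ∀ {A B C D d} z → IsCut A B → IsCut C D → Separated d C D →
                  ¬ ((A +ₛ C) z ⊎ (B +ₛ D) z) → Separated d A B
  gap⇒separated {A} {B} {C} {D} {d} z cutAB cutCD separated z∉ a b Aa Bb = ¬<⇒≥ b-a≮d
    where
    module AB = IsCut cutAB
    module CD = IsCut cutCD
    b-a≮d : ¬ (b -q a) <q d
    b-a≮d b-a<d = AB.infB∉B b (b-min , λ u lb → lb b Bb) Bb
      where
      z-∉C : ∀ {a'} → A a' → ¬ C (z -q a')
      z-∉C {a'} Aa' C = z∉ (inj₁ (a' , z -q a' , Aa' , C , ≃⇒≈ {z} {a' +q (z -q a')} (+q-sub-cancelʳ z a')))
      z-∉D : ∀ {b'} → B b' → ¬ D (z -q b')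
      z-∉D {b'} Bb' D = z∉ (inj₂ (b' , z -q b' , Bb' , D , ≃⇒≈ {z} {b' +q (z -q b')} (+q-sub-cancelʳ z b')))
      squeezed : ∀ c e → C c → D e → (z -q b) ≤q c → e ≤q (z -q a) → ⊥
      squeezed c e Cc De u≤c e≤v =
        <-irrefl (≤<-trans (≤-trans (separated c e Cc De) (-q-mono-≤ e≤v u≤c)) (<-resp (≃-sym (sub-sub-cancelˡ z a b)) ≃-refl b-a<d))
      no-inner-pair : ∀ {a' b'} → A a' → B b' → a <q a' → b' <q b → ⊥
      no-inner-pair {a'} {b'} Aa' Bb' a<a' b'<b =
        <⇒≄ u<u' (≈⇒≃ {u} {u'} (CD.gap≤1 u u' [ (λ Cu → no-D-below-v u Cu ≤-refl) , z-∉D Bb ]′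
                                              [ (λ Cu' → no-D-below-v u' Cu' (<⇒≤ u<u')) , z-∉D Bb' ]′))
        where
        u u' v v' : Q
        u = z -q b
        u' = z -q b'
        v = z -q a
        v' = z -q a'
        u<u' : u <q u'
        u<u' = <⟨ PosQ-resp (≃-sym (sub-sub-cancelˡ z b' b)) (un< b'<b) ⟩
        v'<v : v' <q v
        v'<v = <⟨ PosQ-resp (≃-sym (sub-sub-cancelˡ z a a')) (un< a<a') ⟩
        no-D-below-v : ∀ c → C c → u ≤q c → ⊥
        no-D-below-v c Cc u≤c = <⇒≄ v'<v (≃-sym (≈⇒≃ {v} {v'} (CD.gap≤1 v v'
          [ z-∉C Aa , (λ Dv → squeezed c v Cc Dv u≤c ≤-refl) ]′ [ z-∉C Aa' , (λ Dv' → squeezed c v' Cc Dv' u≤c (<⇒≤ v'<v)) ]′)))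
      a-max : ∀ {b'} → B b' → b' <q b → ∀ a' → A a' → a' ≤ a
      a-max Bb' b'<b a' Aa' = ≤q⇒≤ {a'} {a} (¬<⇒≥ λ a<a' → no-inner-pair Aa' Bb' a<a' b'<b)
      b-min : ∀ b' → B b' → b ≤ b'
      b-min b' Bb' = ≤q⇒≤ {b} {b'} (¬<⇒≥ λ b'<b → AB.supA∉A a (a-max Bb' b'<b , λ u ub → ub a Aa) Aa)

mainTheorem6 : (α : Ordinal) → (A B C D : Arith.Subset α) →
    Arith.IsCut α A B → Arith.Proper α A B →
    Arith.IsCut α C D → Arith.Improper α C D →
    Arith.IsCut α (Arith._+ₛ_ α A C) (Arith._+ₛ_ α B D) ×
    Arith.Improper α (Arith._+ₛ_ α A C) (Arith._+ₛ_ α B D)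
mainTheorem6 α A B C D cutAB properAB cutCD improperCD@(d , d>0 , _) =
  +ₛ-isCut cutAB cutCD sum-covers , separated⇒improper d>0 (+ₛ-separated (IsCut.A<B cutAB) separatedCD)
  where
  open Arith α
  open Cuts α
  separatedCD : Separated d C D
  separatedCD = improper⇒separated (IsCut.A<B cutCD) improperCD
  sum-covers : ∀ z → ¬ ¬ ((A +ₛ C) z ⊎ (B +ₛ D) z)
  sum-covers z z∉ = properAB (separated⇒improper d>0 (gap⇒separated z cutAB cutCD separatedCD z∉))
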